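{- Let $n>10$, $S=\{1,2,4\}\subset\mathbb Z_n$, $\mathbb K$ a field of characteristic $0$ containing all $n$-th roots of unity, and $\lambda\in\mathbb K$ with $\lambda^n=1$. For a word $w=(s_1,\dots,s_m)\in S^m$ put $f_w^{(\lambda)}:=\sum_{a\in\mathbb Z_n}\lambda^{ -a}e_{a,\,a+s_1,\,a+s_1+s_2,\,\ldots,\,a+s_1+\cdots+s_m}$. For $m\ge1$ define, for $0\le k\le m$, \[U_{m,k}:=\sum_{w\in\mathrm{Sh}(1^{m-k},2^k)}(-1)^{\mathrm{inv}(w)}f_w^{(\lambda)},\] and for $0\le k\le m-1$, \[V_{m,k}:=\sum_{w\in\mathrm{Sh}(1^{m-k-1},2^k,4)}(-1)^{\mathrm{inv}(w)}f_w^{(\lambda)}.\] Then for every $m\ge1$, \[\Omega_m^{(\lambda)}=\mathrm{Span}\{U_{m,0},\dots,U_{m,m},V_{m,0},\dots,V_{m,m-1}\},\] hence $\dim\Omega_m^{(\lambda)}=2m+1$; moreover this basis is independent of $\lambda$.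
   Context: GLMY path complex of $\vec{C}_n^S$ (vertex set $\mathbb Z_n$, arrows $a\to a+s$, $s\in S$): elementary paths $e_{v_0\cdots v_m}$ with $\partial e_{v_0\cdots v_m}=\sum_j(-1)^j e_{v_0\cdots\widehat{v_j}\cdots v_m}$, paths with equal consecutive vertices set to zero; $A_m$ is the span of allowed paths; $\Omega_0=A_0$, $\Omega_1=A_1$, $\Omega_m=\{u\in A_m:\partial u\in A_{m-1}\}$. $\Omega_m^{(\lambda)}$ is the $\lambda$-eigenspace in $\Omega_m$ of the shift $\tau e_{v_0\cdots v_m}=e_{v_0+1,\ldots,v_m+1}$. $\mathrm{Sh}(1^{a},2^{b})$ (resp. $\mathrm{Sh}(1^a,2^b,4)$) is the set of words of length $a+b$ (resp. $a+b+1$) with exactly $a$ letters $1$, $b$ letters $2$ (and one letter $4$); $\mathrm{inv}(w)$ is the number of pairs $i<j$ with $w_i>w_j$ for the order $1<2<4$. -}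

module Defs where

open import Level using (_⊔_)
open import Algebra.Bundles using (CommutativeRing)
open import Data.Nat using (ℕ; zero; suc; _∸_; NonZero)
open import Data.Nat.DivMod using (_mod_)
open import Data.Fin using (Fin; toℕ; _≟_)
import Data.Nat as ℕ
open import Data.Vec using (Vec; []; _∷_; insertAt; map)
open import Data.Vec.Properties using (≡-dec)
open import Data.Bool using (Bool; true; false; _∧_; if_then_else_)
open import Data.Product using (Σ; ∃; ∃₂; _×_)
open import Data.Unit using (⊤)
open import Relation.Nullary using (¬_; does)
open import Relation.Binary.PropositionalEquality using (_≡_; _≢_)
open import Function.Bundles using (_⇔_)

data Letter : Set where
  L1 L2 L4 : Letter

val : Letter → ℕ
val L1 = 1
val L2 = 2
val L4 = 4

_<L_ : Letter → Letter → Bool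
L1 <L L2 = true
L1 <L L4 = true
L2 <L L4 = true
_  <L _  = false

_==L_ : Letter → Letter → Bool
L1 ==L L1 = true
L2 ==L L2 = true
L4 ==L L4 = true
_  ==L _  = false

cnt : ∀ {m} → Letter → Vec Letter m → ℕ
cnt x [] = 0
cnt x (y ∷ w) = (if y ==L x then 1 else 0) ℕ.+ cnt x w

countLess : ∀ {m} → Letter → Vec Letter m → ℕ
countLess x [] = 0
countLess x (y ∷ w) = (if y <L x then 1 else 0) ℕ.+ countLess x w

inv : ∀ {m} → Vec Letter m → ℕ
inv [] = 0
inv (x ∷ w) = countLess x w ℕ.+ inv w

_==ℕ_ : ℕ → ℕ → Bool
a ==ℕ b = does (a ℕ.≟ b)

inSh : ∀ {m} → ℕ → ℕ → ℕ → Vec Letter m → Bool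
inSh a b c w = (cnt L1 w ==ℕ a) ∧ ((cnt L2 w ==ℕ b) ∧ (cnt L4 w ==ℕ c))

module _ (n : ℕ) {{_ : NonZero n}} where

  addZ : Fin n → ℕ → Fin n
  addZ a s = (toℕ a ℕ.+ s) mod n

  Arrow : Fin n → Fin n → Set
  Arrow a b = Σ Letter (λ s → b ≡ addZ a (val s))

  Allowed : ∀ {k} → Vec (Fin n) k → Set
  Allowed [] = ⊤
  Allowed (a ∷ []) = ⊤
  Allowed (a ∷ b ∷ p) = Arrow a b × Allowed (b ∷ p)

  Regular : ∀ {k} → Vec (Fin n) k → Set
  Regular [] = ⊤
  Regular (a ∷ []) = ⊤
  Regular (a ∷ b ∷ p) = a ≢ b × Regular (b ∷ p)

  walk : ∀ {m} → Fin n → Vec Letter m → Vec (Fin n) (suc m)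
  walk a [] = a ∷ []
  walk a (s ∷ w) = a ∷ walk (addZ a (val s)) w

module _ {c ℓ} (K : CommutativeRing c ℓ) where
  open CommutativeRing K

  record IsField : Set (c ⊔ ℓ) where
    field
      nontrivial : ¬ (1# ≈ 0#)
      inverse    : ∀ x → ¬ (x ≈ 0#) → ∃ (λ y → x * y ≈ 1#)

  pow : Carrier → ℕ → Carrier
  pow x zero = 1#
  pow x (suc k) = x * pow x k

  ι : ℕ → Carrier
  ι zero = 0#
  ι (suc k) = 1# + ι k

  CharZero : Set ℓ
  CharZero = ∀ k → ¬ (ι (suc k) ≈ 0#)

  -- K contains all n-th roots of unity: there is a primitive n-th root of unity
  HasAllRootsOfUnity : ℕ → Set (c ⊔ ℓ)
  HasAllRootsOfUnity n =
    ∃ (λ ζ → (pow ζ n ≈ 1#) × (∀ k → 0 ℕ.< k → k ℕ.< n → ¬ (pow ζ k ≈ 1#)))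

  sgn : ℕ → Carrier
  sgn zero = 1#
  sgn (suc k) = - sgn k

  ind : Bool → Carrier
  ind true = 1#
  ind false = 0#

  sumFin : ∀ {k} → (Fin k → Carrier) → Carrier
  sumFin {zero} f = 0#
  sumFin {suc k} f = f Fin.zero + sumFin (λ i → f (Fin.suc i))

  sumLetter : (Letter → Carrier) → Carrier
  sumLetter f = f L1 + (f L2 + f L4)

  sumWords : ∀ m → (Vec Letter m → Carrier) → Carrier
  sumWords zero f = f []
  sumWords (suc m) f = sumLetter (λ x → sumWords m (λ w → f (x ∷ w)))

  module _ (n : ℕ) {{_ : NonZero n}} where

    -- m-chains: K-valued coefficient functions on vertex sequences of length m+1
    -- (u = Σ_p u(p) e_p)
    Chain : ℕ → Set c
    Chain m = Vec (Fin n) (suc m) → Carrier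

    _≈C_ : ∀ {m} → Chain m → Chain m → Set ℓ
    u ≈C v = ∀ p → u p ≈ v p

    InA : ∀ {m} → Chain m → Set ℓ
    InA u = ∀ p → ¬ Allowed n p → u p ≈ 0#

    bd : ∀ {m} → Chain (suc m) → Chain m
    bd u q = sumFin (λ j → sgn (toℕ j) * sumFin (λ v → u (insertAt q j v)))

    -- u ∈ Ω_m (for m ≥ 1): u ∈ A_m and ∂u ∈ A_{m-1}
    -- (∂u is taken in the regular path space, so only regular q matter)
    InΩ : ∀ {m} → Chain (suc m) → Set ℓ
    InΩ u = InA u × (∀ q → Regular n q → ¬ Allowed n q → bd u q ≈ 0#)

    -- the shift τ e_{v0..vm} = e_{v0+1,...,vm+1}, on coefficients: (τu)(q) = u(q - 1)
    τ : ∀ {m} → Chain m → Chain m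
    τ u q = u (map (λ a → addZ n a (n ∸ 1)) q)

    InΩλ : Carrier → ∀ {m} → Chain (suc m) → Set ℓ
    InΩλ lam u = InΩ u × (∀ q → τ u q ≈ lam * u q)

    δ : ∀ {k} → Vec (Fin n) k → Vec (Fin n) k → Carrier
    δ p q = ind (does (≡-dec _≟_ p q))

    -- f_w^(λ) = Σ_{a ∈ Z_n} λ^{-a} e_{walk a w},  with λ^{-a} := λ^{n-a} (as λ^n = 1)
    f : Carrier → ∀ {m} → Vec Letter m → Chain m
    f lam w p = sumFin (λ a → pow lam (n ∸ toℕ a) * δ p (walk n a w))

    U : Carrier → (m : ℕ) → Fin (suc m) → Chain m
    U lam m k p = sumWords m (λ w →
      ind (inSh (m ∸ toℕ k) (toℕ k) 0 w) * (sgn (inv w) * f lam w p))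

    V : Carrier → (m : ℕ) → Fin m → Chain m
    V lam m k p = sumWords m (λ w →
      ind (inSh (m ∸ suc (toℕ k)) (toℕ k) 1 w) * (sgn (inv w) * f lam w p))

    comb : Carrier → (m : ℕ) → (Fin (suc m) → Carrier) → (Fin m → Carrier) → Chain m
    comb lam m cs ds p =
      sumFin (λ k → cs k * U lam m k p) + sumFin (λ k → ds k * V lam m k p)

    InSpanUV : Carrier → (m : ℕ) → Chain m → Set (c ⊔ ℓ)
    InSpanUV lam m u = ∃₂ (λ cs ds → u ≈C comb lam m cs ds)

    IndependentUV : Carrier → ℕ → Set (c ⊔ ℓ)
    IndependentUV lam m = ∀ cs ds → (∀ p → comb lam m cs ds p ≈ 0#) →
      (∀ k → cs k ≈ 0#) × (∀ k → ds k ≈ 0#)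

-- A chain u on allowed paths with τ u = λ u is determined by h(w) = u(walk 0 w), namely
-- u = Σ_w h(w) f_w^(λ).  The condition ∂u ∈ A is local: testing it at the regular, non-allowed
-- paths that jump from a to a ⊕ t (t = 3, 5, 6, 8, the two-step sums that are not steps) forces
-- h(…xy…) = −h(…yx…) for distinct letters x, y and h(…44…) = 0, and conversely these relations
-- make all non-allowed coefficients of ∂u cancel.  Such alternating h are determined, up to the
-- sign (−1)^inv(w), by their values on the sorted words 1^(m−k) 2^k and 1^(m−k−1) 2^k 4, and the
-- coefficient functions of U_{m,k} and V_{m,k} are the alternating functions with a single nonzero
-- sorted value; this gives both the spanning property and the independence.

module Submission where

open import Defs
open import Algebra.Bundles using (CommutativeRing)
open import Data.Nat using (ℕ; zero; suc; _<_; _≤_; z≤n; s≤s; _∸_; NonZero)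
import Data.Nat as ℕ
import Data.Nat.Properties as ℕₚ
open import Data.Fin using (Fin; toℕ; fromℕ<)
import Data.Fin as Fin
import Data.Fin.Properties as Finₚ
open import Data.Vec using (Vec; []; _∷_; head; tail)
open import Data.Bool using (true; false; if_then_else_)
import Data.Bool.Properties as Boolₚ
open import Data.Product using (Σ; _×_; _,_; proj₁; proj₂)
open import Data.Sum using (_⊎_; inj₁; inj₂)
open import Data.Empty using (⊥-elim)
open import Function using (_∘_)
open import Function.Bundles using (_⇔_; mk⇔)
open import Relation.Nullary using (¬_; does)
open import Relation.Nullary.Decidable using (dec-true; dec-false)
open import Relation.Binary.PropositionalEquality as ≡ using (_≡_; _≢_)
open import Algebra.Properties.CommutativeSemigroup ℕₚ.+-commutativeSemigroup
  using (x∙yz≈y∙xz)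

module FiniteSums {r ℓ} (K : CommutativeRing r ℓ) where
  open CommutativeRing K hiding (zero)
  open import Algebra.Properties.Ring ring using (-0#≈0#; -‿+-comm; -‿distribˡ-*)
  open import Algebra.Properties.Semiring.Sum semiring using (sum; ∑-distrib-+; *-distribˡ-sum)
  open import Relation.Binary.Reasoning.Setoid setoid

  sumFin≈sum : ∀ {k} (g : Fin k → Carrier) → sumFin K g ≈ sum g
  sumFin≈sum {zero}  g = refl
  sumFin≈sum {suc k} g = +-congˡ (sumFin≈sum (g ∘ Fin.suc))

  sumFin-cong : ∀ {k} {g h : Fin k → Carrier} → (∀ i → g i ≈ h i) → sumFin K g ≈ sumFin K h
  sumFin-cong {zero}  g≈h = refl
  sumFin-cong {suc k} g≈h = +-cong (g≈h Fin.zero) (sumFin-cong (g≈h ∘ Fin.suc))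

  sumFin-zero : ∀ {k} {g : Fin k → Carrier} → (∀ i → g i ≈ 0#) → sumFin K g ≈ 0#
  sumFin-zero {zero}  g≈0 = refl
  sumFin-zero {suc k} g≈0 =
    trans (+-cong (g≈0 Fin.zero) (sumFin-zero (g≈0 ∘ Fin.suc))) (+-identityˡ 0#)

  sumFin-single : ∀ {k} {g : Fin k → Carrier} (i : Fin k) →
                  (∀ j → j ≢ i → g j ≈ 0#) → sumFin K g ≈ g i
  sumFin-single Fin.zero    g≈0 =
    trans (+-congˡ (sumFin-zero (λ j → g≈0 (Fin.suc j) (λ ())))) (+-identityʳ _)
  sumFin-single (Fin.suc i) g≈0 =
    trans (+-cong (g≈0 Fin.zero (λ ()))
                  (sumFin-single i (λ j j≢i → g≈0 (Fin.suc j) (j≢i ∘ Finₚ.suc-injective))))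
          (+-identityˡ _)

  sumFin-neg : ∀ {k} (g : Fin k → Carrier) → sumFin K (λ i → - g i) ≈ - sumFin K g
  sumFin-neg {zero}  g = sym -0#≈0#
  sumFin-neg {suc k} g = trans (+-congˡ (sumFin-neg (g ∘ Fin.suc))) (-‿+-comm _ _)

  sumFin-+ : ∀ {k} (g h : Fin k → Carrier) → sumFin K (λ i → g i + h i) ≈ sumFin K g + sumFin K h
  sumFin-+ g h = begin
    sumFin K (λ i → g i + h i) ≈⟨ sumFin≈sum (λ i → g i + h i) ⟩
    sum (λ i → g i + h i)      ≈⟨ ∑-distrib-+ g h ⟩
    sum g + sum h              ≈⟨ +-cong (sumFin≈sum g) (sumFin≈sum h) ⟨
    sumFin K g + sumFin K h    ∎

  *-distribˡ-sumFin : ∀ {k} x (g : Fin k → Carrier) → x * sumFin K g ≈ sumFin K (λ i → x * g i)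
  *-distribˡ-sumFin x g = begin
    x * sumFin K g            ≈⟨ *-congˡ (sumFin≈sum g) ⟩
    x * sum g                 ≈⟨ *-distribˡ-sum x g ⟩
    sum (λ i → x * g i)       ≈⟨ sumFin≈sum (λ i → x * g i) ⟨
    sumFin K (λ i → x * g i)  ∎

  sumLetter-cong : {g h : Letter → Carrier} → (∀ x → g x ≈ h x) → sumLetter K g ≈ sumLetter K h
  sumLetter-cong g≈h = +-cong (g≈h L1) (+-cong (g≈h L2) (g≈h L4))

  sumLetter-zero : {g : Letter → Carrier} → (∀ x → g x ≈ 0#) → sumLetter K g ≈ 0#
  sumLetter-zero g≈0 =
    trans (+-cong (g≈0 L1) (trans (+-cong (g≈0 L2) (g≈0 L4)) (+-identityˡ 0#))) (+-identityˡ 0#)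

  sumLetter-single : ∀ x {g : Letter → Carrier} → (∀ y → y ≢ x → g y ≈ 0#) → sumLetter K g ≈ g x
  sumLetter-single L1 g≈0 =
    trans (+-congˡ (trans (+-cong (g≈0 L2 (λ ())) (g≈0 L4 (λ ()))) (+-identityˡ 0#))) (+-identityʳ _)
  sumLetter-single L2 g≈0 =
    trans (+-cong (g≈0 L1 (λ ())) (trans (+-congˡ (g≈0 L4 (λ ()))) (+-identityʳ _))) (+-identityˡ _)
  sumLetter-single L4 g≈0 =
    trans (+-cong (g≈0 L1 (λ ())) (trans (+-congʳ (g≈0 L2 (λ ()))) (+-identityˡ _))) (+-identityˡ _)

  sumWords-zero : ∀ m {g : Vec Letter m → Carrier} → (∀ w → g w ≈ 0#) → sumWords K m g ≈ 0#
  sumWords-zero zero    g≈0 = g≈0 []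
  sumWords-zero (suc m) g≈0 = sumLetter-zero (λ x → sumWords-zero m (λ w → g≈0 (x ∷ w)))

  sumWords-single : ∀ m {g : Vec Letter m → Carrier} (v : Vec Letter m) →
                    (∀ w → w ≢ v → g w ≈ 0#) → sumWords K m g ≈ g v
  sumWords-single zero    []      g≈0 = refl
  sumWords-single (suc m) (x ∷ v) g≈0 =
    trans (sumLetter-single x (λ y y≢x → sumWords-zero m (λ w → g≈0 (y ∷ w) (y≢x ∘ ≡.cong head))))
          (sumWords-single m v (λ w w≢v → g≈0 (x ∷ w) (w≢v ∘ ≡.cong tail)))

  sgn-+ : ∀ a b → sgn K (a ℕ.+ b) ≈ sgn K a * sgn K b
  sgn-+ zero    b = sym (*-identityˡ _)
  sgn-+ (suc a) b = trans (-‿cong (sgn-+ a b)) (-‿distribˡ-* _ _)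

  ind-true : ∀ {b} → b ≡ true → ∀ x → ind K b * x ≈ x
  ind-true ≡.refl = *-identityˡ

  ind-false : ∀ {b} → b ≡ false → ∀ x → ind K b * x ≈ 0#
  ind-false ≡.refl = zeroˡ

data AdjacentSwap : ∀ {m} → Vec Letter m → Vec Letter m → Set where
  here  : ∀ {m} x y (v : Vec Letter m) → x ≢ y → AdjacentSwap (x ∷ y ∷ v) (y ∷ x ∷ v)
  there : ∀ {m} z {w w' : Vec Letter m} → AdjacentSwap w w' → AdjacentSwap (z ∷ w) (z ∷ w')

data Contains44 : ∀ {m} → Vec Letter m → Set where
  here  : ∀ {m} (v : Vec Letter m) → Contains44 (L4 ∷ L4 ∷ v)
  there : ∀ {m} z {w : Vec Letter m} → Contains44 w → Contains44 (z ∷ w)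

sortedWord : (m a b : ℕ) → Vec Letter m
sortedWord zero    _       _       = []
sortedWord (suc m) (suc a) b       = L1 ∷ sortedWord m a b
sortedWord (suc m) zero    (suc b) = L2 ∷ sortedWord m zero b
sortedWord (suc m) zero    zero    = L4 ∷ sortedWord m zero zero

countLess-L1 : ∀ {m} (w : Vec Letter m) → countLess L1 w ≡ 0
countLess-L1 []       = ≡.refl
countLess-L1 (L1 ∷ w) = countLess-L1 w
countLess-L1 (L2 ∷ w) = countLess-L1 w
countLess-L1 (L4 ∷ w) = countLess-L1 w

countLess-L2 : ∀ {m} (w : Vec Letter m) → countLess L2 w ≡ cnt L1 w
countLess-L2 []       = ≡.refl
countLess-L2 (L1 ∷ w) = ≡.cong suc (countLess-L2 w)
countLess-L2 (L2 ∷ w) = countLess-L2 w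
countLess-L2 (L4 ∷ w) = countLess-L2 w

countLess-L4 : ∀ {m} (w : Vec Letter m) → countLess L4 w ≡ cnt L1 w ℕ.+ cnt L2 w
countLess-L4 []       = ≡.refl
countLess-L4 (L1 ∷ w) = ≡.cong suc (countLess-L4 w)
countLess-L4 (L2 ∷ w) = ≡.trans (≡.cong suc (countLess-L4 w)) (≡.sym (ℕₚ.+-suc (cnt L1 w) (cnt L2 w)))
countLess-L4 (L4 ∷ w) = countLess-L4 w

cnt-total : ∀ {m} (w : Vec Letter m) → cnt L1 w ℕ.+ cnt L2 w ℕ.+ cnt L4 w ≡ m
cnt-total []       = ≡.refl
cnt-total (L1 ∷ w) = ≡.cong suc (cnt-total w)
cnt-total (L2 ∷ w) =
  ≡.trans (≡.cong (ℕ._+ cnt L4 w) (ℕₚ.+-suc (cnt L1 w) (cnt L2 w))) (≡.cong suc (cnt-total w))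
cnt-total (L4 ∷ w) = ≡.trans (ℕₚ.+-suc (cnt L1 w ℕ.+ cnt L2 w) (cnt L4 w)) (≡.cong suc (cnt-total w))

countLess-cong : ∀ {m} z (w w' : Vec Letter m) → cnt L1 w ≡ cnt L1 w' → cnt L2 w ≡ cnt L2 w' →
                 countLess z w ≡ countLess z w'
countLess-cong L1 w w' _   _   = ≡.trans (countLess-L1 w) (≡.sym (countLess-L1 w'))
countLess-cong L2 w w' eq₁ _   = ≡.trans (countLess-L2 w) (≡.trans eq₁ (≡.sym (countLess-L2 w')))
countLess-cong L4 w w' eq₁ eq₂ =
  ≡.trans (countLess-L4 w) (≡.trans (≡.cong₂ ℕ._+_ eq₁ eq₂) (≡.sym (countLess-L4 w')))

cnt-sortedWord : ∀ m a b → a ℕ.+ b ≤ m →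
  (cnt L1 (sortedWord m a b) ≡ a) × (cnt L2 (sortedWord m a b) ≡ b) ×
  (cnt L4 (sortedWord m a b) ≡ m ∸ (a ℕ.+ b))
cnt-sortedWord zero    zero    zero    _         = ≡.refl , ≡.refl , ≡.refl
cnt-sortedWord (suc m) (suc a) b       (s≤s a+b≤m) with cnt-sortedWord m a b a+b≤m
... | e₁ , e₂ , e₄ = ≡.cong suc e₁ , e₂ , e₄
cnt-sortedWord (suc m) zero    (suc b) (s≤s b≤m) with cnt-sortedWord m zero b b≤m
... | e₁ , e₂ , e₄ = e₁ , ≡.cong suc e₂ , e₄
cnt-sortedWord (suc m) zero    zero    _         with cnt-sortedWord m zero zero z≤n
... | e₁ , e₂ , e₄ = e₁ , e₂ , ≡.cong suc e₄

inv-sortedWord : ∀ m a b → inv (sortedWord m a b) ≡ 0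
inv-sortedWord zero    a       b       = ≡.refl
inv-sortedWord (suc m) (suc a) b       =
  ≡.cong₂ ℕ._+_ (countLess-L1 (sortedWord m a b)) (inv-sortedWord m a b)
inv-sortedWord (suc m) zero    (suc b) =
  ≡.cong₂ ℕ._+_ (≡.trans (countLess-L2 (sortedWord m zero b)) (no1 m b)) (inv-sortedWord m zero b)
  where
  no1 : ∀ m b → cnt L1 (sortedWord m zero b) ≡ 0
  no1 zero    b       = ≡.refl
  no1 (suc m) zero    = no1 m zero
  no1 (suc m) (suc b) = no1 m b
inv-sortedWord (suc m) zero    zero    =
  ≡.cong₂ ℕ._+_ (≡.trans (countLess-L4 (sortedWord m zero zero)) (no12 m)) (inv-sortedWord m zero zero)
  where
  no12 : ∀ m → cnt L1 (sortedWord m zero zero) ℕ.+ cnt L2 (sortedWord m zero zero) ≡ 0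
  no12 zero    = ≡.refl
  no12 (suc m) = no12 m

cnt-swap : ∀ {m} {w w' : Vec Letter m} → AdjacentSwap w w' → ∀ z → cnt z w ≡ cnt z w'
cnt-swap (here x y v _) z = x∙yz≈y∙xz (if x ==L z then 1 else 0) (if y ==L z then 1 else 0) (cnt z v)
cnt-swap (there y s)    z = ≡.cong (_ ℕ.+_) (cnt-swap s z)

-- The swapped pair contributes one inversion on exactly one side; all other pairs are unchanged.
inv-swap : ∀ {m} {w w' : Vec Letter m} → AdjacentSwap w w' → inv w ≡ suc (inv w') ⊎ inv w' ≡ suc (inv w)
inv-swap (here L1 L1 v x≢y) = ⊥-elim (x≢y ≡.refl)
inv-swap (here L2 L2 v x≢y) = ⊥-elim (x≢y ≡.refl)
inv-swap (here L4 L4 v x≢y) = ⊥-elim (x≢y ≡.refl)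
inv-swap (here L1 L2 v _) = inj₂ (≡.cong suc (x∙yz≈y∙xz (countLess L2 v) (countLess L1 v) (inv v)))
inv-swap (here L1 L4 v _) = inj₂ (≡.cong suc (x∙yz≈y∙xz (countLess L4 v) (countLess L1 v) (inv v)))
inv-swap (here L2 L4 v _) = inj₂ (≡.cong suc (x∙yz≈y∙xz (countLess L4 v) (countLess L2 v) (inv v)))
inv-swap (here L2 L1 v _) = inj₁ (≡.cong suc (x∙yz≈y∙xz (countLess L2 v) (countLess L1 v) (inv v)))
inv-swap (here L4 L1 v _) = inj₁ (≡.cong suc (x∙yz≈y∙xz (countLess L4 v) (countLess L1 v) (inv v)))
inv-swap (here L4 L2 v _) = inj₁ (≡.cong suc (x∙yz≈y∙xz (countLess L4 v) (countLess L2 v) (inv v)))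
inv-swap {w = z ∷ w} {z ∷ w'} (there z s)
  with inv-swap s | countLess-cong z w w' (cnt-swap s L1) (cnt-swap s L2)
... | inj₁ eq | same = inj₁ (≡.trans (≡.cong₂ ℕ._+_ same eq) (ℕₚ.+-suc _ _))
... | inj₂ eq | same = inj₂ (≡.trans (≡.cong₂ ℕ._+_ (≡.sym same) eq) (ℕₚ.+-suc _ _))

2≤cnt4 : ∀ {m} {w : Vec Letter m} → Contains44 w → 2 ≤ cnt L4 w
2≤cnt4 (here v)     = s≤s (s≤s z≤n)
2≤cnt4 (there L1 h) = 2≤cnt4 h
2≤cnt4 (there L2 h) = 2≤cnt4 h
2≤cnt4 (there L4 h) = ℕₚ.m≤n⇒m≤1+n (2≤cnt4 h)

inSh-true : ∀ {m} (w : Vec Letter m) {a b d} →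
            cnt L1 w ≡ a → cnt L2 w ≡ b → cnt L4 w ≡ d → inSh a b d w ≡ true
inSh-true w {a} {b} {d} e₁ e₂ e₄
  rewrite dec-true (cnt L1 w ℕ.≟ a) e₁ | dec-true (cnt L2 w ℕ.≟ b) e₂ | dec-true (cnt L4 w ℕ.≟ d) e₄
  = ≡.refl

inSh-false₂ : ∀ {m} (w : Vec Letter m) {a b d} → cnt L2 w ≢ b → inSh a b d w ≡ false
inSh-false₂ w {a} {b} ne rewrite dec-false (cnt L2 w ℕ.≟ b) ne = Boolₚ.∧-zeroʳ (cnt L1 w ==ℕ a)

inSh-false₄ : ∀ {m} (w : Vec Letter m) {a b d} → cnt L4 w ≢ d → inSh a b d w ≡ false
inSh-false₄ w {a} {b} {d} ne
  rewrite dec-false (cnt L4 w ℕ.≟ d) ne | Boolₚ.∧-zeroʳ (cnt L2 w ==ℕ b)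
  = Boolₚ.∧-zeroʳ (cnt L1 w ==ℕ a)

sortedWord-contains44 : ∀ m a b → 2 ℕ.+ (a ℕ.+ b) ≤ m → Contains44 (sortedWord m a b)
sortedWord-contains44 (suc (suc m)) zero    zero    _        = here _
sortedWord-contains44 (suc m)       (suc a) b       (s≤s le) = there L1 (sortedWord-contains44 m a b le)
sortedWord-contains44 (suc m)       zero    (suc b) (s≤s le) = there L2 (sortedWord-contains44 m zero b le)

sortedU : (m : ℕ) → Fin (suc m) → Vec Letter m
sortedU m k = sortedWord m (m ∸ toℕ k) (toℕ k)

sortedV : (m : ℕ) → Fin m → Vec Letter m
sortedV m k = sortedWord m (m ∸ suc (toℕ k)) (toℕ k)

cnt-sortedU : ∀ m (k : Fin (suc m)) →
  (cnt L1 (sortedU m k) ≡ m ∸ toℕ k) × (cnt L2 (sortedU m k) ≡ toℕ k) × (cnt L4 (sortedU m k) ≡ 0)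
cnt-sortedU m k = proj₁ counts , proj₁ (proj₂ counts) ,
                  ≡.trans (proj₂ (proj₂ counts)) (≡.trans (≡.cong (m ∸_) a+k≡m) (ℕₚ.n∸n≡0 m))
  where
  a+k≡m : m ∸ toℕ k ℕ.+ toℕ k ≡ m
  a+k≡m = ℕₚ.m∸n+n≡m (ℕₚ.≤-pred (Finₚ.toℕ<n k))
  counts = cnt-sortedWord m (m ∸ toℕ k) (toℕ k) (ℕₚ.≤-reflexive a+k≡m)

cnt-sortedV : ∀ m (k : Fin m) →
  (cnt L1 (sortedV m k) ≡ m ∸ suc (toℕ k)) × (cnt L2 (sortedV m k) ≡ toℕ k) × (cnt L4 (sortedV m k) ≡ 1)
cnt-sortedV m k = proj₁ counts , proj₁ (proj₂ counts) ,
                  ≡.trans (proj₂ (proj₂ counts))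
                          (≡.trans (≡.cong (_∸ (a ℕ.+ toℕ k)) (≡.sym a+k+1≡m)) (ℕₚ.m+n∸m≡n (a ℕ.+ toℕ k) 1))
  where
  a = m ∸ suc (toℕ k)
  a+k+1≡m : a ℕ.+ toℕ k ℕ.+ 1 ≡ m
  a+k+1≡m = ≡.trans (ℕₚ.+-comm _ 1)
              (≡.trans (≡.sym (ℕₚ.+-suc a (toℕ k))) (ℕₚ.m∸n+n≡m (Finₚ.toℕ<n k)))
  counts = cnt-sortedWord m a (toℕ k) (ℕₚ.m+n≤o⇒m≤o _ (ℕₚ.≤-reflexive a+k+1≡m))

m+n≡o⇒m≡o∸n : ∀ {m n o} → m ℕ.+ n ≡ o → m ≡ o ∸ n
m+n≡o⇒m≡o∸n {m} {n} eq = ≡.trans (≡.sym (ℕₚ.m+n∸n≡m m n)) (≡.cong (_∸ n) eq)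

cnt-total-with : ∀ {m d} (w : Vec Letter m) → cnt L4 w ≡ d → cnt L1 w ℕ.+ cnt L2 w ℕ.+ d ≡ m
cnt-total-with w ≡.refl = cnt-total w

no4⇒shapeU : ∀ {m} (w : Vec Letter m) → cnt L4 w ≡ 0 →
             Σ (Fin (suc m)) λ k → (cnt L1 w ≡ m ∸ toℕ k) × (cnt L2 w ≡ toℕ k)
no4⇒shapeU {m} w no4 =
  k , m+n≡o⇒m≡o∸n (≡.trans (≡.cong (cnt L1 w ℕ.+_) k≡c₂) c₁+c₂≡m) , ≡.sym k≡c₂
  where
  c₁+c₂≡m : cnt L1 w ℕ.+ cnt L2 w ≡ m
  c₁+c₂≡m = ≡.trans (≡.sym (ℕₚ.+-identityʳ _)) (cnt-total-with w no4)
  k : Fin (suc m)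
  k = fromℕ< (s≤s (≡.subst (cnt L2 w ≤_) c₁+c₂≡m (ℕₚ.m≤n+m _ _)))
  k≡c₂ : toℕ k ≡ cnt L2 w
  k≡c₂ = Finₚ.toℕ-fromℕ< _

one4⇒shapeV : ∀ {m} (w : Vec Letter m) → cnt L4 w ≡ 1 →
              Σ (Fin m) λ k → (cnt L1 w ≡ m ∸ suc (toℕ k)) × (cnt L2 w ≡ toℕ k)
one4⇒shapeV {m} w one4 =
  k , m+n≡o⇒m≡o∸n (≡.trans (≡.cong (λ b → cnt L1 w ℕ.+ suc b) k≡c₂) c₁+c₂+1≡m) ,
  ≡.sym k≡c₂
  where
  c₁+c₂+1≡m : cnt L1 w ℕ.+ suc (cnt L2 w) ≡ m
  c₁+c₂+1≡m = ≡.trans (ℕₚ.+-suc _ _) (≡.trans (ℕₚ.+-comm 1 _) (cnt-total-with w one4))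
  k : Fin m
  k = fromℕ< (≡.subst (suc (cnt L2 w) ≤_) c₁+c₂+1≡m (ℕₚ.m≤n+m _ _))
  k≡c₂ : toℕ k ≡ cnt L2 w
  k≡c₂ = Finₚ.toℕ-fromℕ< _

many4⇒sortedContains44 : ∀ {m} (w : Vec Letter m) → 2 ≤ cnt L4 w →
                          Contains44 (sortedWord m (cnt L1 w) (cnt L2 w))
many4⇒sortedContains44 {m} w 2≤c₄ = sortedWord-contains44 m (cnt L1 w) (cnt L2 w)
  (≡.subst (2 ℕ.+ (cnt L1 w ℕ.+ cnt L2 w) ≤_)
     (≡.trans (ℕₚ.+-comm (cnt L4 w) (cnt L1 w ℕ.+ cnt L2 w)) (cnt-total w)) (ℕₚ.+-monoˡ-≤ _ 2≤c₄))

module AlternatingWords {r ℓ} (K : CommutativeRing r ℓ) where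
  open CommutativeRing K hiding (zero)
  open import Algebra.Properties.Ring ring
    using (-0#≈0#; -‿+-comm; -‿involutive; -‿distribˡ-*; -‿distribʳ-*)
  open import Relation.Binary.Reasoning.Setoid setoid
  open FiniteSums K

  record Alternating {m} (h : Vec Letter m → Carrier) : Set ℓ where
    field
      antisymmetric : ∀ {w w'} → AdjacentSwap w w' → h w ≈ - h w'
      vanishes-44   : ∀ {w} → Contains44 w → h w ≈ 0#
  open Alternating public

  alternating-tail : ∀ {m} {h : Vec Letter (suc m) → Carrier} x → Alternating h →
                     Alternating (λ w → h (x ∷ w))
  alternating-tail x alt = record
    { antisymmetric = antisymmetric alt ∘ there x
    ; vanishes-44   = vanishes-44 alt ∘ there x }

  alternating-scale : ∀ {m} {h : Vec Letter m → Carrier} k → Alternating h →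
                      Alternating (λ w → k * h w)
  alternating-scale k alt = record
    { antisymmetric = λ s → trans (*-congˡ (antisymmetric alt s)) (sym (-‿distribʳ-* k _))
    ; vanishes-44   = λ c → trans (*-congˡ (vanishes-44 alt c)) (zeroʳ k) }

  alternating-+ : ∀ {m} {h h' : Vec Letter m → Carrier} → Alternating h → Alternating h' →
                  Alternating (λ w → h w + h' w)
  alternating-+ alt alt' = record
    { antisymmetric = λ s → trans (+-cong (antisymmetric alt s) (antisymmetric alt' s)) (-‿+-comm _ _)
    ; vanishes-44   = λ c → trans (+-cong (vanishes-44 alt c) (vanishes-44 alt' c)) (+-identityˡ 0#) }

  alternating-sumFin : ∀ {m k} {h : Fin k → Vec Letter m → Carrier} → (∀ i → Alternating (h i)) →
                       Alternating (λ w → sumFin K (λ i → h i w))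
  alternating-sumFin {k = zero}  _   = record { antisymmetric = λ _ → sym -0#≈0# ; vanishes-44 = λ _ → refl }
  alternating-sumFin {k = suc k} alt = alternating-+ (alt Fin.zero) (alternating-sumFin (alt ∘ Fin.suc))

  sgn-swap : ∀ {m} {w w' : Vec Letter m} → AdjacentSwap w w' → sgn K (inv w) ≈ - sgn K (inv w')
  sgn-swap s with inv-swap s
  ... | inj₁ eq rewrite eq = refl
  ... | inj₂ eq rewrite eq = sym (-‿involutive _)

  signedShuffle : ∀ {m} → ℕ → ℕ → ℕ → Vec Letter m → Carrier
  signedShuffle a b d w = ind K (inSh a b d w) * sgn K (inv w)

  signedShuffle-alternating : ∀ {m} a b d → d ≤ 1 → Alternating (signedShuffle {m} a b d)
  signedShuffle-alternating a b d d≤1 = record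
    { antisymmetric = λ s → trans (*-cong (reflexive (≡.cong (ind K) (sameShuffle s))) (sgn-swap s))
                                  (sym (-‿distribʳ-* _ _))
    ; vanishes-44   = λ {w} c →
        ind-false (inSh-false₄ w (λ eq → ℕₚ.<⇒≱ (2≤cnt4 c) (≡.subst (_≤ 1) (≡.sym eq) d≤1)))
                  (sgn K (inv w)) }
    where
    sameShuffle : ∀ {m} {w w' : Vec Letter m} → AdjacentSwap w w' → inSh a b d w ≡ inSh a b d w'
    sameShuffle s rewrite cnt-swap s L1 | cnt-swap s L2 | cnt-swap s L4 = ≡.refl

  -- The coefficient of f_w in Σ_k cs_k U_{m,k} + Σ_k ds_k V_{m,k}.
  shuffleCombination : ∀ m → (Fin (suc m) → Carrier) → (Fin m → Carrier) → Vec Letter m → Carrier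
  shuffleCombination m cs ds w = sumFin K (λ k → cs k * signedShuffle (m ∸ toℕ k) (toℕ k) 0 w)
                               + sumFin K (λ k → ds k * signedShuffle (m ∸ suc (toℕ k)) (toℕ k) 1 w)

  shuffleCombination-alternating : ∀ m cs ds → Alternating (shuffleCombination m cs ds)
  shuffleCombination-alternating m cs ds = alternating-+
    (alternating-sumFin (λ k → alternating-scale (cs k)
      (signedShuffle-alternating (m ∸ toℕ k) (toℕ k) 0 z≤n)))
    (alternating-sumFin (λ k → alternating-scale (ds k)
      (signedShuffle-alternating (m ∸ suc (toℕ k)) (toℕ k) 1 (s≤s z≤n))))

  insert2-sorted : ∀ {m} {h : Vec Letter (suc m) → Carrier} → Alternating h → ∀ a b → a ≤ m →
                   h (L2 ∷ sortedWord m a b) ≈ sgn K a * h (sortedWord (suc m) a (suc b))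
  insert2-sorted             alt zero    b _         = sym (*-identityˡ _)
  insert2-sorted {suc m} {h} alt (suc a) b (s≤s a≤m) = begin
    h (L2 ∷ L1 ∷ sortedWord m a b)
      ≈⟨ antisymmetric alt (here L2 L1 _ (λ ())) ⟩
    - h (L1 ∷ L2 ∷ sortedWord m a b)
      ≈⟨ -‿cong (insert2-sorted (alternating-tail L1 alt) a b a≤m) ⟩
    - (sgn K a * h (L1 ∷ sortedWord (suc m) a (suc b)))
      ≈⟨ -‿distribˡ-* _ _ ⟩
    - sgn K a * h (L1 ∷ sortedWord (suc m) a (suc b))    ∎

  insert4-sorted : ∀ {m} {h : Vec Letter (suc m) → Carrier} → Alternating h → ∀ a b → a ℕ.+ b ≤ m →
                   h (L4 ∷ sortedWord m a b) ≈ sgn K (a ℕ.+ b) * h (sortedWord (suc m) a b)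
  insert4-sorted             alt zero    zero    _           = sym (*-identityˡ _)
  insert4-sorted {suc m} {h} alt (suc a) b       (s≤s a+b≤m) = begin
    h (L4 ∷ L1 ∷ sortedWord m a b)
      ≈⟨ antisymmetric alt (here L4 L1 _ (λ ())) ⟩
    - h (L1 ∷ L4 ∷ sortedWord m a b)
      ≈⟨ -‿cong (insert4-sorted (alternating-tail L1 alt) a b a+b≤m) ⟩
    - (sgn K (a ℕ.+ b) * h (L1 ∷ sortedWord (suc m) a b))
      ≈⟨ -‿distribˡ-* _ _ ⟩
    - sgn K (a ℕ.+ b) * h (L1 ∷ sortedWord (suc m) a b)   ∎
  insert4-sorted {suc m} {h} alt zero    (suc b) (s≤s b≤m)   = begin
    h (L4 ∷ L2 ∷ sortedWord m zero b)
      ≈⟨ antisymmetric alt (here L4 L2 _ (λ ())) ⟩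
    - h (L2 ∷ L4 ∷ sortedWord m zero b)
      ≈⟨ -‿cong (insert4-sorted (alternating-tail L2 alt) zero b b≤m) ⟩
    - (sgn K b * h (L2 ∷ sortedWord (suc m) zero b))
      ≈⟨ -‿distribˡ-* _ _ ⟩
    - sgn K b * h (L2 ∷ sortedWord (suc m) zero b)       ∎

  -- Sorting w by adjacent swaps takes exactly inv(w) of them.
  normalForm : ∀ {m} {h : Vec Letter m → Carrier} → Alternating h →
               ∀ w → h w ≈ sgn K (inv w) * h (sortedWord m (cnt L1 w) (cnt L2 w))
  normalForm alt [] = sym (*-identityˡ _)
  normalForm {suc m} {h} alt (x ∷ w) = begin
    h (x ∷ w)                                             ≈⟨ normalForm (alternating-tail x alt) w ⟩
    sgn K (inv w) * h (x ∷ sorted)                        ≈⟨ *-congˡ (insert x) ⟩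
    sgn K (inv w) * (sgn K (countLess x w) * h (sorted⁺ x)) ≈⟨ *-assoc _ _ _ ⟨
    (sgn K (inv w) * sgn K (countLess x w)) * h (sorted⁺ x)
      ≈⟨ *-congʳ (trans (*-comm _ _) (sym (sgn-+ (countLess x w) (inv w)))) ⟩
    sgn K (inv (x ∷ w)) * h (sorted⁺ x)                   ∎
    where
    sorted : Vec Letter m
    sorted = sortedWord m (cnt L1 w) (cnt L2 w)
    sorted⁺ : Letter → Vec Letter (suc m)
    sorted⁺ x = sortedWord (suc m) (cnt L1 (x ∷ w)) (cnt L2 (x ∷ w))
    c₁+c₂≤m : cnt L1 w ℕ.+ cnt L2 w ≤ m
    c₁+c₂≤m = ℕₚ.m+n≤o⇒m≤o _ (ℕₚ.≤-reflexive (cnt-total w))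
    insert : ∀ x → h (x ∷ sorted) ≈ sgn K (countLess x w) * h (sorted⁺ x)
    insert L1 = trans (sym (*-identityˡ _)) (*-congʳ (reflexive (≡.cong (sgn K) (≡.sym (countLess-L1 w)))))
    insert L2 = trans (insert2-sorted alt (cnt L1 w) (cnt L2 w) (ℕₚ.m+n≤o⇒m≤o _ c₁+c₂≤m))
                      (*-congʳ (reflexive (≡.cong (sgn K) (≡.sym (countLess-L2 w)))))
    insert L4 = trans (insert4-sorted alt (cnt L1 w) (cnt L2 w) c₁+c₂≤m)
                      (*-congʳ (reflexive (≡.cong (sgn K) (≡.sym (countLess-L4 w)))))

  signedShuffle-on : ∀ {m} a b d (w : Vec Letter m) → inSh a b d w ≡ true →
                     signedShuffle a b d w ≈ sgn K (inv w)
  signedShuffle-on a b d w eq = ind-true eq (sgn K (inv w))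

  signedShuffle-off : ∀ {m} a b d (w : Vec Letter m) → inSh a b d w ≡ false →
                      ∀ x → x * signedShuffle a b d w ≈ 0#
  signedShuffle-off a b d w eq x = trans (*-congˡ (ind-false eq (sgn K (inv w)))) (zeroʳ x)

  shuffleCombination-U : ∀ m cs ds (w : Vec Letter m) (i : Fin (suc m)) →
    cnt L1 w ≡ m ∸ toℕ i → cnt L2 w ≡ toℕ i → cnt L4 w ≡ 0 →
    shuffleCombination m cs ds w ≈ cs i * sgn K (inv w)
  shuffleCombination-U m cs ds w i e₁ e₂ e₄ = trans (+-cong onlyU noV) (+-identityʳ _)
    where
    onlyU : sumFin K (λ k → cs k * signedShuffle (m ∸ toℕ k) (toℕ k) 0 w) ≈ cs i * sgn K (inv w)
    onlyU = trans
      (sumFin-single i (λ j j≢i → signedShuffle-off (m ∸ toℕ j) (toℕ j) 0 w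
        (inSh-false₂ w (λ e → j≢i (Finₚ.toℕ-injective (≡.trans (≡.sym e) e₂)))) (cs j)))
      (*-congˡ (signedShuffle-on (m ∸ toℕ i) (toℕ i) 0 w (inSh-true w e₁ e₂ e₄)))
    noV : sumFin K (λ k → ds k * signedShuffle (m ∸ suc (toℕ k)) (toℕ k) 1 w) ≈ 0#
    noV = sumFin-zero (λ k → signedShuffle-off (m ∸ suc (toℕ k)) (toℕ k) 1 w
      (inSh-false₄ w (ℕₚ.0≢1+n ∘ ≡.trans (≡.sym e₄))) (ds k))

  shuffleCombination-V : ∀ m cs ds (w : Vec Letter m) (i : Fin m) →
    cnt L1 w ≡ m ∸ suc (toℕ i) → cnt L2 w ≡ toℕ i → cnt L4 w ≡ 1 →
    shuffleCombination m cs ds w ≈ ds i * sgn K (inv w)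
  shuffleCombination-V m cs ds w i e₁ e₂ e₄ = trans (+-cong noU onlyV) (+-identityˡ _)
    where
    onlyV : sumFin K (λ k → ds k * signedShuffle (m ∸ suc (toℕ k)) (toℕ k) 1 w) ≈ ds i * sgn K (inv w)
    onlyV = trans
      (sumFin-single i (λ j j≢i → signedShuffle-off (m ∸ suc (toℕ j)) (toℕ j) 1 w
        (inSh-false₂ w (λ e → j≢i (Finₚ.toℕ-injective (≡.trans (≡.sym e) e₂)))) (ds j)))
      (*-congˡ (signedShuffle-on (m ∸ suc (toℕ i)) (toℕ i) 1 w (inSh-true w e₁ e₂ e₄)))
    noU : sumFin K (λ k → cs k * signedShuffle (m ∸ toℕ k) (toℕ k) 0 w) ≈ 0#
    noU = sumFin-zero (λ k → signedShuffle-off (m ∸ toℕ k) (toℕ k) 0 w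
      (inSh-false₄ w (ℕₚ.1+n≢0 ∘ ≡.trans (≡.sym e₄))) (cs k))

  shuffleCombination-sortedU : ∀ m cs ds (k : Fin (suc m)) → shuffleCombination m cs ds (sortedU m k) ≈ cs k
  shuffleCombination-sortedU m cs ds k with cnt-sortedU m k
  ... | e₁ , e₂ , e₄ = trans (shuffleCombination-U m cs ds (sortedU m k) k e₁ e₂ e₄)
    (trans (*-congˡ (reflexive (≡.cong (sgn K) (inv-sortedWord m _ _)))) (*-identityʳ _))

  shuffleCombination-sortedV : ∀ m cs ds (k : Fin m) → shuffleCombination m cs ds (sortedV m k) ≈ ds k
  shuffleCombination-sortedV m cs ds k with cnt-sortedV m k
  ... | e₁ , e₂ , e₄ = trans (shuffleCombination-V m cs ds (sortedV m k) k e₁ e₂ e₄)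
    (trans (*-congˡ (reflexive (≡.cong (sgn K) (inv-sortedWord m _ _)))) (*-identityʳ _))

  alternating-ext : ∀ {m} {h h' : Vec Letter m → Carrier} → Alternating h → Alternating h' →
    (∀ k → h (sortedU m k) ≈ h' (sortedU m k)) → (∀ k → h (sortedV m k) ≈ h' (sortedV m k)) →
    ∀ w → h w ≈ h' w
  alternating-ext {m} {h} {h'} alt alt' onU onV w = begin
    h w                         ≈⟨ normalForm alt w ⟩
    sgn K (inv w) * h sorted    ≈⟨ *-congˡ (onSorted (cnt L4 w) ≡.refl) ⟩
    sgn K (inv w) * h' sorted   ≈⟨ normalForm alt' w ⟨
    h' w                        ∎
    where
    sorted = sortedWord m (cnt L1 w) (cnt L2 w)
    onSorted : ∀ d → cnt L4 w ≡ d → h sorted ≈ h' sorted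
    onSorted 0 e₄ with no4⇒shapeU w e₄
    ... | k , e₁ , e₂ rewrite e₁ | e₂ = onU k
    onSorted 1 e₄ with one4⇒shapeV w e₄
    ... | k , e₁ , e₂ rewrite e₁ | e₂ = onV k
    onSorted (suc (suc d)) e₄ = trans (vanishes-44 alt many) (sym (vanishes-44 alt' many))
      where
      many = many4⇒sortedContains44 w (≡.subst (2 ≤_) (≡.sym e₄) (s≤s (s≤s z≤n)))

  alternating-expansion : ∀ {m} {h : Vec Letter m → Carrier} → Alternating h →
    ∀ w → h w ≈ shuffleCombination m (λ k → h (sortedU m k)) (λ k → h (sortedV m k)) w
  alternating-expansion {m} {h} alt = alternating-ext alt (shuffleCombination-alternating m cs ds)
    (λ k → sym (shuffleCombination-sortedU m cs ds k)) (λ k → sym (shuffleCombination-sortedV m cs ds k))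
    where
    cs = λ k → h (sortedU m k)
    ds = λ k → h (sortedV m k)

module Circulant (n' : ℕ) (8<n : 8 < suc n') where
  open import Data.Nat.DivMod using (_%_; %-distribˡ-+; m%n%n≡m%n; m<n⇒m%n≡m; [m+n]%n≡m%n)
  open import Data.Vec using (map)
  import Data.Vec.Properties as Vecₚ
  open import Data.Unit using (tt)
  open import Relation.Nullary using (Dec; yes; no)
  open ≡.≡-Reasoning

  n : ℕ
  n = suc n'

  infixl 6 _⊕_
  _⊕_ : Fin n → ℕ → Fin n
  _⊕_ = addZ n

  toℕ-⊕ : ∀ a s → toℕ (a ⊕ s) ≡ (toℕ a ℕ.+ s) % n
  toℕ-⊕ a s = Finₚ.toℕ-fromℕ< _

  toℕ%n : ∀ a → toℕ a % n ≡ toℕ a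
  toℕ%n a = m<n⇒m%n≡m (Finₚ.toℕ<n a)

  %-absorbˡ : ∀ x j → (x % n ℕ.+ j) % n ≡ (x ℕ.+ j) % n
  %-absorbˡ x j = begin
    (x % n ℕ.+ j) % n            ≡⟨ %-distribˡ-+ (x % n) j n ⟩
    (x % n % n ℕ.+ j % n) % n    ≡⟨ ≡.cong (λ t → (t ℕ.+ j % n) % n) (m%n%n≡m%n x n) ⟩
    (x % n ℕ.+ j % n) % n        ≡⟨ %-distribˡ-+ x j n ⟨
    (x ℕ.+ j) % n                ∎

  ⊕-assoc : ∀ a i j → a ⊕ i ⊕ j ≡ a ⊕ (i ℕ.+ j)
  ⊕-assoc a i j = Finₚ.toℕ-injective (begin
    toℕ (a ⊕ i ⊕ j)                ≡⟨ toℕ-⊕ (a ⊕ i) j ⟩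
    (toℕ (a ⊕ i) ℕ.+ j) % n         ≡⟨ ≡.cong (λ t → (t ℕ.+ j) % n) (toℕ-⊕ a i) ⟩
    ((toℕ a ℕ.+ i) % n ℕ.+ j) % n   ≡⟨ %-absorbˡ (toℕ a ℕ.+ i) j ⟩
    (toℕ a ℕ.+ i ℕ.+ j) % n         ≡⟨ ≡.cong (_% n) (ℕₚ.+-assoc (toℕ a) i j) ⟩
    (toℕ a ℕ.+ (i ℕ.+ j)) % n       ≡⟨ toℕ-⊕ a (i ℕ.+ j) ⟨
    toℕ (a ⊕ (i ℕ.+ j))            ∎)

  ⊕-swap : ∀ a i j → a ⊕ i ⊕ j ≡ a ⊕ j ⊕ i
  ⊕-swap a i j = begin
    a ⊕ i ⊕ j      ≡⟨ ⊕-assoc a i j ⟩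
    a ⊕ (i ℕ.+ j)  ≡⟨ ≡.cong (a ⊕_) (ℕₚ.+-comm i j) ⟩
    a ⊕ (j ℕ.+ i)  ≡⟨ ⊕-assoc a j i ⟨
    a ⊕ j ⊕ i      ∎

  ⊕-identityʳ : ∀ a → a ⊕ 0 ≡ a
  ⊕-identityʳ a = Finₚ.toℕ-injective
    (≡.trans (toℕ-⊕ a 0) (≡.trans (≡.cong (_% n) (ℕₚ.+-identityʳ (toℕ a))) (toℕ%n a)))

  ⊕-n : ∀ a → a ⊕ n ≡ a
  ⊕-n a = Finₚ.toℕ-injective (≡.trans (toℕ-⊕ a n) (≡.trans ([m+n]%n≡m%n (toℕ a) n) (toℕ%n a)))

  [a+[x+[n∸a]]]%n≡x%n : ∀ a x → (toℕ a ℕ.+ (x ℕ.+ (n ∸ toℕ a))) % n ≡ x % n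
  [a+[x+[n∸a]]]%n≡x%n a x = begin
    (toℕ a ℕ.+ (x ℕ.+ (n ∸ toℕ a))) % n  ≡⟨ ≡.cong (_% n) (x∙yz≈y∙xz (toℕ a) x _) ⟩
    (x ℕ.+ (toℕ a ℕ.+ (n ∸ toℕ a))) % n  ≡⟨ ≡.cong (λ t → (x ℕ.+ t) % n) a+[n∸a]≡n ⟩
    (x ℕ.+ n) % n                        ≡⟨ [m+n]%n≡m%n x n ⟩
    x % n                                ∎
    where a+[n∸a]≡n = ℕₚ.m+[n∸m]≡n (ℕₚ.<⇒≤ (Finₚ.toℕ<n a))

  ⊕-cancelˡ : ∀ a {p q} → p < n → q < n → a ⊕ p ≡ a ⊕ q → p ≡ q
  ⊕-cancelˡ a {p} {q} p<n q<n eq = begin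
    p                             ≡⟨ back p p<n ⟨
    toℕ (a ⊕ p ⊕ (n ∸ toℕ a))     ≡⟨ ≡.cong (λ b → toℕ (b ⊕ (n ∸ toℕ a))) eq ⟩
    toℕ (a ⊕ q ⊕ (n ∸ toℕ a))     ≡⟨ back q q<n ⟩
    q                             ∎
    where
    back : ∀ x → x < n → toℕ (a ⊕ x ⊕ (n ∸ toℕ a)) ≡ x
    back x x<n = ≡.trans (≡.cong toℕ (⊕-assoc a x (n ∸ toℕ a)))
      (≡.trans (toℕ-⊕ a _) (≡.trans ([a+[x+[n∸a]]]%n≡x%n a x) (m<n⇒m%n≡m x<n)))

  ⊕-difference : ∀ a b → Σ ℕ (λ t → t < n × b ≡ a ⊕ t)
  ⊕-difference a b = toℕ d , Finₚ.toℕ<n d , Finₚ.toℕ-injective (≡.sym (begin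
    toℕ (a ⊕ toℕ d)                             ≡⟨ toℕ-⊕ a (toℕ d) ⟩
    (toℕ a ℕ.+ toℕ d) % n                        ≡⟨ ≡.cong (λ t → (toℕ a ℕ.+ t) % n) (toℕ-⊕ b _) ⟩
    (toℕ a ℕ.+ (b+[n∸a]) % n) % n                ≡⟨ ≡.cong (_% n) (ℕₚ.+-comm (toℕ a) _) ⟩
    ((b+[n∸a]) % n ℕ.+ toℕ a) % n                ≡⟨ %-absorbˡ b+[n∸a] (toℕ a) ⟩
    (b+[n∸a] ℕ.+ toℕ a) % n                      ≡⟨ ≡.cong (_% n) (ℕₚ.+-comm _ (toℕ a)) ⟩
    (toℕ a ℕ.+ (toℕ b ℕ.+ (n ∸ toℕ a))) % n      ≡⟨ [a+[x+[n∸a]]]%n≡x%n a (toℕ b) ⟩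
    toℕ b % n                                   ≡⟨ toℕ%n b ⟩
    toℕ b                                       ∎))
    where
    b+[n∸a] = toℕ b ℕ.+ (n ∸ toℕ a)
    d = b ⊕ (n ∸ toℕ a)

  ≤8⇒<n : ∀ {x} → x ≤ 8 → x < n
  ≤8⇒<n x≤8 = ℕₚ.≤-<-trans x≤8 8<n

  val≤4 : ∀ s → val s ≤ 4
  val≤4 L1 = s≤s z≤n
  val≤4 L2 = s≤s (s≤s z≤n)
  val≤4 L4 = ℕₚ.≤-refl

  val<n : ∀ s → val s < n
  val<n s = ≤8⇒<n (ℕₚ.≤-trans (val≤4 s) (ℕₚ.m≤m+n 4 4))

  val+val<n : ∀ x y → val x ℕ.+ val y < n
  val+val<n x y = ≤8⇒<n (ℕₚ.+-mono-≤ (val≤4 x) (val≤4 y))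

  val-injective : ∀ {s t} → val s ≡ val t → s ≡ t
  val-injective {L1} {L1} _ = ≡.refl
  val-injective {L2} {L2} _ = ≡.refl
  val-injective {L4} {L4} _ = ≡.refl
  val-injective {L1} {L2} ()
  val-injective {L1} {L4} ()
  val-injective {L2} {L1} ()
  val-injective {L2} {L4} ()
  val-injective {L4} {L1} ()
  val-injective {L4} {L2} ()

  step-injective : ∀ a {s t} → a ⊕ val s ≡ a ⊕ val t → s ≡ t
  step-injective a {s} {t} eq = val-injective (⊕-cancelˡ a (val<n s) (val<n t) eq)

  ⊕-fixes-only-0 : ∀ a {t} → t < n → a ⊕ t ≡ a → t ≡ 0
  ⊕-fixes-only-0 a t<n eq = ⊕-cancelˡ a t<n (s≤s z≤n) (≡.trans eq (≡.sym (⊕-identityʳ a)))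

  step≢ : ∀ a s → a ⊕ val s ≢ a
  step≢ a s eq with ⊕-fixes-only-0 a (val<n s) eq
  step≢ a L1 eq | ()
  step≢ a L2 eq | ()
  step≢ a L4 eq | ()

  Arrow? : ∀ a b → Dec (Arrow n a b)
  Arrow? a b with b Fin.≟ a ⊕ 1 | b Fin.≟ a ⊕ 2 | b Fin.≟ a ⊕ 4
  ... | yes e | _     | _     = yes (L1 , e)
  ... | no _  | yes e | _     = yes (L2 , e)
  ... | no _  | no _  | yes e = yes (L4 , e)
  ... | no ¬1 | no ¬2 | no ¬4 = no λ { (L1 , e) → ¬1 e ; (L2 , e) → ¬2 e ; (L4 , e) → ¬4 e }

  Allowed? : ∀ {k} (p : Vec (Fin n) k) → Dec (Allowed n p)
  Allowed? []          = yes tt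
  Allowed? (a ∷ [])    = yes tt
  Allowed? (a ∷ b ∷ p) with Arrow? a b | Allowed? (b ∷ p)
  ... | yes ab | yes bp = yes (ab , bp)
  ... | no ¬ab | _      = no (¬ab ∘ proj₁)
  ... | _      | no ¬bp = no (¬bp ∘ proj₂)

  Allowed-head : ∀ {k} b (q : Vec (Fin n) (suc k)) → Allowed n (b ∷ q) → Arrow n b (head q)
  Allowed-head b (_ ∷ [])    al = proj₁ al
  Allowed-head b (_ ∷ _ ∷ _) al = proj₁ al

  Regular-∷ : ∀ {k} a (q : Vec (Fin n) (suc k)) → a ≢ head q → Regular n q → Regular n (a ∷ q)
  Regular-∷ a (_ ∷ [])    a≢b _   = a≢b , tt
  Regular-∷ a (_ ∷ _ ∷ _) a≢b reg = a≢b , reg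

  head-walk : ∀ {m} a (w : Vec Letter m) → head (walk n a w) ≡ a
  head-walk a []      = ≡.refl
  head-walk a (_ ∷ _) = ≡.refl

  walk-allowed : ∀ {m} a (w : Vec Letter m) → Allowed n (walk n a w)
  walk-allowed a []          = tt
  walk-allowed a (s ∷ [])    = (s , ≡.refl) , tt
  walk-allowed a (s ∷ t ∷ w) = (s , ≡.refl) , walk-allowed (a ⊕ val s) (t ∷ w)

  walk-regular : ∀ {m} a (w : Vec Letter m) → Regular n (walk n a w)
  walk-regular a []      = tt
  walk-regular a (s ∷ w) = Regular-∷ a (walk n (a ⊕ val s) w)
    (λ eq → step≢ a s (≡.sym (≡.trans eq (head-walk _ w)))) (walk-regular (a ⊕ val s) w)

  allowed⇒walk : ∀ {m} (p : Vec (Fin n) (suc m)) → Allowed n p →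
                 Σ (Vec Letter m) (λ w → p ≡ walk n (head p) w)
  allowed⇒walk (a ∷ [])    _               = [] , ≡.refl
  allowed⇒walk (a ∷ b ∷ p) ((s , b≡) , al) with allowed⇒walk (b ∷ p) al
  ... | w , eq = s ∷ w , ≡.cong (a ∷_) (≡.trans eq (≡.cong (λ x → walk n x w) b≡))

  walk-injective : ∀ {m} a b (w w' : Vec Letter m) → walk n a w ≡ walk n b w' → (a ≡ b) × (w ≡ w')
  walk-injective a b []      []       ≡.refl = ≡.refl , ≡.refl
  walk-injective a b (s ∷ w) (t ∷ w') eq with ≡.cong head eq
  ... | ≡.refl with walk-injective _ _ w w' (≡.cong tail eq)
  ...   | next≡ , ≡.refl with step-injective a next≡
  ...     | ≡.refl = ≡.refl , ≡.refl

  -- τ moves every vertex by n ∸ 1 = n'.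
  shift : Fin n → Fin n
  shift a = a ⊕ n'

  shift-walk : ∀ {m} a (w : Vec Letter m) → map shift (walk n a w) ≡ walk n (shift a) w
  shift-walk a []      = ≡.refl
  shift-walk a (s ∷ w) = ≡.cong (shift a ∷_)
    (≡.trans (shift-walk (a ⊕ val s) w) (≡.cong (λ x → walk n x w) (⊕-swap a (val s) n')))

  Allowed-map⊕ : ∀ {k} t (q : Vec (Fin n) k) → Allowed n q → Allowed n (map (_⊕ t) q)
  Allowed-map⊕ t []          _               = tt
  Allowed-map⊕ t (a ∷ [])    _               = tt
  Allowed-map⊕ t (a ∷ b ∷ q) ((s , b≡) , al) =
    (s , ≡.trans (≡.cong (_⊕ t) b≡) (⊕-swap a (val s) t)) , Allowed-map⊕ t (b ∷ q) al

  Allowed-unshift : ∀ {k} (q : Vec (Fin n) k) → Allowed n (map shift q) → Allowed n q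
  Allowed-unshift q al = ≡.subst (Allowed n) unshift-q (Allowed-map⊕ 1 (map shift q) al)
    where
    shift⊕1 : ∀ a → shift a ⊕ 1 ≡ a
    shift⊕1 a = ≡.trans (⊕-assoc a n' 1) (≡.trans (≡.cong (a ⊕_) (ℕₚ.+-comm n' 1)) (⊕-n a))
    unshift-q : map (_⊕ 1) (map shift q) ≡ q
    unshift-q = begin
      map (_⊕ 1) (map shift q)  ≡⟨ Vecₚ.map-∘ (_⊕ 1) shift q ⟨
      map (λ a → shift a ⊕ 1) q ≡⟨ Vecₚ.map-cong shift⊕1 q ⟩
      map (λ a → a) q           ≡⟨ Vecₚ.map-id q ⟩
      q                         ∎

  toℕ-shift-zero : toℕ (shift Fin.zero) ≡ n'
  toℕ-shift-zero = ≡.trans (toℕ-⊕ Fin.zero n') (m<n⇒m%n≡m (ℕₚ.n<1+n n'))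

  toℕ-shift-suc : ∀ (j : Fin n') → toℕ (shift (Fin.suc j)) ≡ toℕ j
  toℕ-shift-suc j = begin
    toℕ (shift (Fin.suc j))     ≡⟨ toℕ-⊕ (Fin.suc j) n' ⟩
    (suc (toℕ j) ℕ.+ n') % n     ≡⟨ ≡.cong (_% n) (ℕₚ.+-suc (toℕ j) n') ⟨
    (toℕ j ℕ.+ n) % n            ≡⟨ [m+n]%n≡m%n (toℕ j) n ⟩
    toℕ j % n                    ≡⟨ m<n⇒m%n≡m (ℕₚ.m<n⇒m<1+n (Finₚ.toℕ<n j)) ⟩
    toℕ j                        ∎

module Boundary {r ℓ} (K : CommutativeRing r ℓ) (n' : ℕ) (8<n : 8 < suc n') where
  open CommutativeRing K hiding (zero)
  open import Algebra.Properties.Ring ring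
    using (-0#≈0#; -‿involutive; -‿distribˡ-*; +-inverseˡ-unique; +-inverseʳ-unique)
  open import Relation.Binary.Reasoning.Setoid setoid
  open import Data.Vec using (insertAt)
  open import Data.Unit using (tt)
  open import Relation.Nullary using (yes; no)
  open FiniteSums K
  open AlternatingWords K
  open Circulant n' 8<n

  -- bd K n u is ∂ u; ∂ is also needed on vertex sequences of length 1.
  ∂ : ∀ {k} → (Vec (Fin n) (suc k) → Carrier) → Vec (Fin n) k → Carrier
  ∂ g q = sumFin K (λ j → sgn K (toℕ j) * sumFin K (λ v → g (insertAt q j v)))

  ∂-cons : ∀ {k} (g : Vec (Fin n) (suc (suc k)) → Carrier) a q →
           ∂ g (a ∷ q) ≈ sumFin K (λ v → g (v ∷ a ∷ q)) + - ∂ (λ p → g (a ∷ p)) q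
  ∂-cons g a q = +-cong (*-identityˡ _) (trans
    (sumFin-cong (λ j → sym (-‿distribˡ-* (sgn K (toℕ j)) (inserted j))))
    (sumFin-neg (λ j → sgn K (toℕ j) * inserted j)))
    where
    inserted = λ j → sumFin K (λ v → g (a ∷ insertAt q j v))

  ∂-zero : ∀ {k} {g : Vec (Fin n) (suc k) → Carrier} → (∀ p → g p ≈ 0#) → ∀ q → ∂ g q ≈ 0#
  ∂-zero g≈0 q = sumFin-zero (λ j →
    trans (*-congˡ (sumFin-zero (λ v → g≈0 (insertAt q j v)))) (zeroʳ (sgn K (toℕ j))))

  ∂-cons-no-incoming : ∀ {k} (g : Vec (Fin n) (suc (suc k)) → Carrier) a q →
                       (∀ v → g (v ∷ a ∷ q) ≈ 0#) → ∂ g (a ∷ q) ≈ - ∂ (λ p → g (a ∷ p)) q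
  ∂-cons-no-incoming g a q g≈0 = trans (∂-cons g a q) (trans (+-congʳ (sumFin-zero g≈0)) (+-identityˡ _))

  neg≈0 : ∀ {x} → x ≈ 0# → - x ≈ 0#
  neg≈0 x≈0 = trans (-‿cong x≈0) -0#≈0#

  neg≈0⇒≈0 : ∀ {x} → - x ≈ 0# → x ≈ 0#
  neg≈0⇒≈0 -x≈0 = trans (sym (-‿involutive _)) (neg≈0 -x≈0)

  -- g = u(a₀ ∷ −) for a chain u whose path from a₀ along a word w has coefficient H w.
  record Rooted {k} (a₀ : Fin n) (g : Vec (Fin n) (suc k) → Carrier) (H : Vec Letter (suc k) → Carrier) :
                Set ℓ where
    field
      supported : ∀ p → ¬ Allowed n (a₀ ∷ p) → g p ≈ 0#
      on-walks  : ∀ s w → g (walk n (a₀ ⊕ val s) w) ≈ H (s ∷ w)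
  open Rooted

  rooted-tail : ∀ {k a₀} {g : Vec (Fin n) (suc (suc k)) → Carrier} {H} → Rooted a₀ g H → ∀ s →
                Rooted (a₀ ⊕ val s) (λ p → g (a₀ ⊕ val s ∷ p)) (λ w → H (s ∷ w))
  rooted-tail ro s = record
    { supported = λ p ¬al → supported ro _ (¬al ∘ proj₂)
    ; on-walks  = λ x w → on-walks ro s (x ∷ w) }

  ∂-after-arrow : ∀ {k a₀} {g : Vec (Fin n) (suc (suc k)) → Carrier} {H} → Rooted a₀ g H → ∀ s q →
                  ¬ Allowed n (a₀ ⊕ val s ∷ q) →
                  ∂ g (a₀ ⊕ val s ∷ q) ≈ - ∂ (λ p → g (a₀ ⊕ val s ∷ p)) q
  ∂-after-arrow {a₀ = a₀} {g} ro s q ¬al = ∂-cons-no-incoming g (a₀ ⊕ val s) q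
    (λ v → supported ro (v ∷ a₀ ⊕ val s ∷ q) (¬al ∘ proj₂ ∘ proj₂))

  ∂-after-non-arrow : ∀ {k a₀} {g : Vec (Fin n) (suc (suc k)) → Carrier} {H} → Rooted a₀ g H →
                      ∀ q → ¬ Arrow n a₀ (head q) → ∂ g q ≈ sumFin K (λ v → g (v ∷ q))
  ∂-after-non-arrow {g = g} ro (b ∷ q) ¬ab = trans (∂-cons g b q)
    (trans (+-congˡ (neg≈0 (∂-zero (λ p → supported ro (b ∷ p) (¬ab ∘ proj₁)) q))) (+-identityʳ _))

  expand-by-arrow : ∀ b q (G : Letter → Carrier) X → (∀ s → q ≡ b ⊕ val s → X ≈ G s) →
                    (¬ Arrow n b q → X ≈ 0#) →
                    X ≈ sumLetter K (λ s → ind K (does (q Fin.≟ b ⊕ val s)) * G s)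
  expand-by-arrow b q G X onArrow offArrow with Arrow? b q
  ... | yes (s , q≡) = trans (onArrow s q≡) (sym (trans
        (sumLetter-single s (λ t t≢s → ind-false
          (dec-false (q Fin.≟ _) (λ q≡' → t≢s (step-injective b (≡.trans (≡.sym q≡') q≡)))) (G t)))
        (ind-true (dec-true (q Fin.≟ _) q≡) (G s))))
  ... | no ¬ab = trans (offArrow ¬ab)
        (sym (sumLetter-zero (λ t → ind-false (dec-false (q Fin.≟ _) (λ q≡ → ¬ab (t , q≡))) (G t))))

  sumFin-out-neighbours : ∀ b (F : Fin n → Carrier) → (∀ v → ¬ Arrow n b v → F v ≈ 0#) →
                          sumFin K F ≈ sumLetter K (λ s → F (b ⊕ val s))
  sumFin-out-neighbours b F off = begin
    sumFin K F
      ≈⟨ sumFin-cong (λ v → expand-by-arrow b v (λ _ → F v) (F v) (λ _ _ → refl) (off v)) ⟩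
    sumFin K (λ v → I L1 v + (I L2 v + I L4 v))
      ≈⟨ sumFin-+ (I L1) (λ v → I L2 v + I L4 v) ⟩
    sumFin K (I L1) + sumFin K (λ v → I L2 v + I L4 v)
      ≈⟨ +-congˡ (sumFin-+ (I L2) (I L4)) ⟩
    sumLetter K (λ s → sumFin K (I s))
      ≈⟨ sumLetter-cong (λ s → sumFin-single (b ⊕ val s) (λ v v≢ →
           ind-false (dec-false (v Fin.≟ b ⊕ val s) v≢) (F v))) ⟩
    sumLetter K (λ s → I s (b ⊕ val s))
      ≈⟨ sumLetter-cong (λ s → ind-true (dec-true (b ⊕ val s Fin.≟ _) ≡.refl) (F (b ⊕ val s))) ⟩
    sumLetter K (λ s → F (b ⊕ val s))
      ∎
    where
    I : Letter → Fin n → Carrier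
    I s v = ind K (does (v Fin.≟ b ⊕ val s)) * F v

  pairSum : ∀ {k} → ℕ → (Vec Letter (suc (suc k)) → Carrier) → Vec Letter k → Carrier
  pairSum t H v =
    sumLetter K (λ x → sumLetter K (λ y → ind K ((val x ℕ.+ val y) ==ℕ t) * H (x ∷ y ∷ v)))

  sum-before-walk : ∀ {k a₀} {g : Vec (Fin n) (suc (suc k)) → Carrier} {H} → Rooted a₀ g H →
                    ∀ t → t < n → ∀ w →
                    sumFin K (λ v → g (v ∷ walk n (a₀ ⊕ t) w)) ≈ pairSum t H w
  sum-before-walk {a₀ = a₀} {g} {H} ro t t<n w = begin
    sumFin K (λ v → g (v ∷ Q))
      ≈⟨ sumFin-out-neighbours a₀ _ (λ v ¬av → supported ro (v ∷ Q) (¬av ∘ proj₁)) ⟩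
    sumLetter K (λ x → g (a₀ ⊕ val x ∷ Q))
      ≈⟨ sumLetter-cong (λ x → expand-by-arrow (a₀ ⊕ val x) (a₀ ⊕ t) (λ y → H (x ∷ y ∷ w)) _
                                               (onArrow x) (offArrow x)) ⟩
    sumLetter K (λ x → sumLetter K (λ y →
      ind K (does (a₀ ⊕ t Fin.≟ a₀ ⊕ val x ⊕ val y)) * H (x ∷ y ∷ w)))
      ≈⟨ sumLetter-cong (λ x → sumLetter-cong (λ y →
           *-congʳ {H (x ∷ y ∷ w)} (reflexive (≡.cong (ind K) (sameIndicator x y))))) ⟩
    pairSum t H w
      ∎
    where
    Q = walk n (a₀ ⊕ t) w
    onArrow : ∀ x y → a₀ ⊕ t ≡ a₀ ⊕ val x ⊕ val y → g (a₀ ⊕ val x ∷ Q) ≈ H (x ∷ y ∷ w)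
    onArrow x y t≡ = ≡.subst (λ q → g (a₀ ⊕ val x ∷ walk n q w) ≈ H (x ∷ y ∷ w)) (≡.sym t≡)
                             (on-walks ro x (y ∷ w))
    offArrow : ∀ x → ¬ Arrow n (a₀ ⊕ val x) (a₀ ⊕ t) → g (a₀ ⊕ val x ∷ Q) ≈ 0#
    offArrow x ¬ar = supported ro _ (λ al → ¬ar (≡.subst (Arrow n (a₀ ⊕ val x)) (head-walk (a₀ ⊕ t) w)
                                                        (Allowed-head (a₀ ⊕ val x) Q (proj₂ al))))
    sameIndicator : ∀ x y → does (a₀ ⊕ t Fin.≟ a₀ ⊕ val x ⊕ val y) ≡ ((val x ℕ.+ val y) ==ℕ t)
    sameIndicator x y with (val x ℕ.+ val y) ℕ.≟ t
    ... | yes x+y≡t = ≡.trans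
      (dec-true (_ Fin.≟ _) (≡.trans (≡.cong (a₀ ⊕_) (≡.sym x+y≡t)) (≡.sym (⊕-assoc a₀ _ _))))
      (≡.sym (dec-true (_ ℕ.≟ t) x+y≡t))
    ... | no  x+y≢t = ≡.trans
      (dec-false (_ Fin.≟ _) (λ eq →
        x+y≢t (≡.sym (⊕-cancelˡ a₀ t<n (val+val<n x y) (≡.trans eq (⊕-assoc a₀ _ _))))))
      (≡.sym (dec-false (_ ℕ.≟ t) x+y≢t))

  -- For a numeral t, pairSum t H v computes to three rows Σ_y ind b_y * H (x ∷ y ∷ v) with literal
  -- b_y, and ind false = 0#, ind true = 1#.
  select-none : ∀ a b c → 0# * a + (0# * b + 0# * c) ≈ 0#
  select-none a b c =
    trans (+-cong (zeroˡ a) (trans (+-cong (zeroˡ b) (zeroˡ c)) (+-identityˡ 0#))) (+-identityˡ 0#)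

  select₁ : ∀ a b c → 1# * a + (0# * b + 0# * c) ≈ a
  select₁ a b c =
    trans (+-cong (*-identityˡ a) (trans (+-cong (zeroˡ b) (zeroˡ c)) (+-identityˡ 0#))) (+-identityʳ a)

  select₂ : ∀ a b c → 0# * a + (1# * b + 0# * c) ≈ b
  select₂ a b c =
    trans (+-cong (zeroˡ a) (trans (+-cong (*-identityˡ b) (zeroˡ c)) (+-identityʳ b))) (+-identityˡ b)

  select₄ : ∀ a b c → 0# * a + (0# * b + 1# * c) ≈ c
  select₄ a b c =
    trans (+-cong (zeroˡ a) (trans (+-cong (zeroˡ b) (*-identityˡ c)) (+-identityˡ c))) (+-identityˡ c)

  module _ {k} (H : Vec Letter (suc (suc k)) → Carrier) (v : Vec Letter k) where

    pairSum-3 : pairSum 3 H v ≈ H (L1 ∷ L2 ∷ v) + H (L2 ∷ L1 ∷ v)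
    pairSum-3 = trans (+-cong (select₂ _ _ _) (+-cong (select₁ _ _ _) (select-none _ _ _)))
                      (+-congˡ (+-identityʳ _))

    pairSum-5 : pairSum 5 H v ≈ H (L1 ∷ L4 ∷ v) + H (L4 ∷ L1 ∷ v)
    pairSum-5 = trans (+-cong (select₄ _ _ _) (+-cong (select-none _ _ _) (select₁ _ _ _)))
                      (+-congˡ (+-identityˡ _))

    pairSum-6 : pairSum 6 H v ≈ H (L2 ∷ L4 ∷ v) + H (L4 ∷ L2 ∷ v)
    pairSum-6 = trans (+-cong (select-none _ _ _) (+-cong (select₄ _ _ _) (select₂ _ _ _)))
                      (+-identityˡ _)

    pairSum-8 : pairSum 8 H v ≈ H (L4 ∷ L4 ∷ v)
    pairSum-8 = trans (+-cong (select-none _ _ _) (+-cong (select-none _ _ _) (select₄ _ _ _)))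
                      (trans (+-identityˡ _) (+-identityˡ _))

    pairSum-none : ∀ {t} → (∀ x y → val x ℕ.+ val y ≢ t) → pairSum t H v ≈ 0#
    pairSum-none {t} ≢t = sumLetter-zero (λ x → sumLetter-zero (λ y →
      ind-false (dec-false (val x ℕ.+ val y ℕ.≟ t) (≢t x y)) (H (x ∷ y ∷ v))))

  -- The two-step words with sum t ∉ S are xy and yx (t = 3, 5, 6), or 44 (t = 8), or there are none.
  alternating-pairSum : ∀ {k} {H : Vec Letter (suc (suc k)) → Carrier} → Alternating H →
                        ∀ t → (∀ s → t ≢ val s) → ∀ v → pairSum t H v ≈ 0#
  alternating-pairSum {H = H} alt t t∉S v with t ℕ.≟ 3 | t ℕ.≟ 5 | t ℕ.≟ 6 | t ℕ.≟ 8
  ... | yes ≡.refl | _ | _ | _ =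
    trans (pairSum-3 H v) (trans (+-congʳ (antisymmetric alt (here L1 L2 v (λ ())))) (-‿inverseˡ _))
  ... | no _ | yes ≡.refl | _ | _ =
    trans (pairSum-5 H v) (trans (+-congʳ (antisymmetric alt (here L1 L4 v (λ ())))) (-‿inverseˡ _))
  ... | no _ | no _ | yes ≡.refl | _ =
    trans (pairSum-6 H v) (trans (+-congʳ (antisymmetric alt (here L2 L4 v (λ ())))) (-‿inverseˡ _))
  ... | no _ | no _ | no _ | yes ≡.refl = trans (pairSum-8 H v) (vanishes-44 alt (here v))
  ... | no ≢3 | no ≢5 | no ≢6 | no ≢8 = pairSum-none H v sums
    where
    sums : ∀ x y → val x ℕ.+ val y ≢ t
    sums L1 L1 eq = t∉S L2 (≡.sym eq)
    sums L1 L2 eq = ≢3 (≡.sym eq)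
    sums L1 L4 eq = ≢5 (≡.sym eq)
    sums L2 L1 eq = ≢3 (≡.sym eq)
    sums L2 L2 eq = t∉S L4 (≡.sym eq)
    sums L2 L4 eq = ≢6 (≡.sym eq)
    sums L4 L1 eq = ≢5 (≡.sym eq)
    sums L4 L2 eq = ≢6 (≡.sym eq)
    sums L4 L4 eq = ≢8 (≡.sym eq)

  alternating⇒∂-allowed : ∀ {k a₀} {g : Vec (Fin n) (suc k) → Carrier} {H} → Rooted a₀ g H →
                          Alternating H → ∀ q → ¬ Allowed n (a₀ ∷ q) → ∂ g q ≈ 0#
  alternating⇒∂-allowed ro alt [] ¬al = ⊥-elim (¬al tt)
  alternating⇒∂-allowed {a₀ = a₀} {g} ro alt (b ∷ q) ¬al with Arrow? a₀ b
  ... | yes (s , ≡.refl) = trans (∂-after-arrow ro s q ¬al')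
          (neg≈0 (alternating⇒∂-allowed (rooted-tail ro s) (alternating-tail s alt) q ¬al'))
    where
    ¬al' : ¬ Allowed n (a₀ ⊕ val s ∷ q)
    ¬al' al = ¬al ((s , ≡.refl) , al)
  ... | no ¬ab = trans (∂-after-non-arrow ro (b ∷ q) ¬ab) afterNonArrow
    where
    afterNonArrow : sumFin K (λ v → g (v ∷ b ∷ q)) ≈ 0#
    afterNonArrow with Allowed? (b ∷ q)
    ... | no ¬bq = sumFin-zero (λ v → supported ro (v ∷ b ∷ q) (¬bq ∘ proj₂ ∘ proj₂))
    ... | yes bq with allowed⇒walk (b ∷ q) bq | ⊕-difference a₀ b
    ...   | w , bq≡walk | t , t<n , b≡ = ≡.subst (λ p → sumFin K (λ v → g (v ∷ p)) ≈ 0#)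
            (≡.trans (≡.cong (λ c → walk n c w) (≡.sym b≡)) (≡.sym bq≡walk))
            (trans (sum-before-walk ro t t<n w) (alternating-pairSum alt t t∉S w))
      where
      t∉S : ∀ s → t ≢ val s
      t∉S s t≡ = ¬ab (s , ≡.trans b≡ (≡.cong (a₀ ⊕_) t≡))

  BoundaryAllowedAfter : ∀ {k} → Fin n → (Vec (Fin n) (suc k) → Carrier) → Set ℓ
  BoundaryAllowedAfter a₀ g = ∀ q → Regular n (a₀ ∷ q) → ¬ Allowed n (a₀ ∷ q) → ∂ g q ≈ 0#

  boundaryAllowed-tail : ∀ {k a₀} {g : Vec (Fin n) (suc (suc k)) → Carrier} {H} → Rooted a₀ g H →
                         BoundaryAllowedAfter a₀ g →
                         ∀ s → BoundaryAllowedAfter (a₀ ⊕ val s) (λ p → g (a₀ ⊕ val s ∷ p))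
  boundaryAllowed-tail {a₀ = a₀} ro ba s q reg ¬al = neg≈0⇒≈0 (trans
    (sym (∂-after-arrow ro s q ¬al))
    (ba (a₀ ⊕ val s ∷ q) ((λ eq → step≢ a₀ s (≡.sym eq)) , reg) (¬al ∘ proj₂)))

  -- ∂ g at the regular, non-allowed path (a₀ ⊕ t) followed by the walk v sees exactly the two-step
  -- walks from a₀ to a₀ ⊕ t.
  pairSum-non-step : ∀ {k a₀} {g : Vec (Fin n) (suc (suc k)) → Carrier} {H} → Rooted a₀ g H →
                     BoundaryAllowedAfter a₀ g → ∀ t → t < n → t ≢ 0 → (∀ s → t ≢ val s) →
                     ∀ v → pairSum t H v ≈ 0#
  pairSum-non-step {a₀ = a₀} {g} {H} ro ba t t<n t≢0 t∉S v = begin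
    pairSum t H v               ≈⟨ sum-before-walk ro t t<n v ⟨
    sumFin K (λ u → g (u ∷ Q))  ≈⟨ ∂-after-non-arrow ro Q ¬arrow ⟨
    ∂ g Q                       ≈⟨ ba Q regular (¬arrow ∘ Allowed-head a₀ Q) ⟩
    0#                          ∎
    where
    Q = walk n (a₀ ⊕ t) v
    Q-head : head Q ≡ a₀ ⊕ t
    Q-head = head-walk (a₀ ⊕ t) v
    ¬arrow : ¬ Arrow n a₀ (head Q)
    ¬arrow (s , eq) = t∉S s (⊕-cancelˡ a₀ t<n (val<n s) (≡.trans (≡.sym Q-head) eq))
    regular : Regular n (a₀ ∷ Q)
    regular = Regular-∷ a₀ Q (λ eq → t≢0 (⊕-fixes-only-0 a₀ t<n (≡.sym (≡.trans eq Q-head))))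
                        (walk-regular (a₀ ⊕ t) v)

  non-step-pairSums : ∀ {k a₀} {g : Vec (Fin n) (suc (suc k)) → Carrier} {H} → Rooted a₀ g H →
    BoundaryAllowedAfter a₀ g → ∀ v →
    (pairSum 3 H v ≈ 0#) × (pairSum 5 H v ≈ 0#) × (pairSum 6 H v ≈ 0#) × (pairSum 8 H v ≈ 0#)
  non-step-pairSums ro ba v =
      pairSum-non-step ro ba 3 (val+val<n L1 L2) (λ ()) (λ { L1 () ; L2 () ; L4 () }) v
    , pairSum-non-step ro ba 5 (val+val<n L1 L4) (λ ()) (λ { L1 () ; L2 () ; L4 () }) v
    , pairSum-non-step ro ba 6 (val+val<n L2 L4) (λ ()) (λ { L1 () ; L2 () ; L4 () }) v
    , pairSum-non-step ro ba 8 (val+val<n L4 L4) (λ ()) (λ { L1 () ; L2 () ; L4 () }) v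

  ∂-allowed⇒antisymmetric : ∀ {k a₀} {g : Vec (Fin n) (suc k) → Carrier} {H} {w w'} → Rooted a₀ g H →
                            BoundaryAllowedAfter a₀ g → AdjacentSwap w w' → H w ≈ - H w'
  ∂-allowed⇒antisymmetric ro ba (here L1 L1 _ x≢y) = ⊥-elim (x≢y ≡.refl)
  ∂-allowed⇒antisymmetric ro ba (here L2 L2 _ x≢y) = ⊥-elim (x≢y ≡.refl)
  ∂-allowed⇒antisymmetric ro ba (here L4 L4 _ x≢y) = ⊥-elim (x≢y ≡.refl)
  ∂-allowed⇒antisymmetric {H = H} ro ba (here L1 L2 v _) =
    +-inverseˡ-unique _ _ (trans (sym (pairSum-3 H v)) (proj₁ (non-step-pairSums ro ba v)))
  ∂-allowed⇒antisymmetric {H = H} ro ba (here L2 L1 v _) =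
    +-inverseʳ-unique _ _ (trans (sym (pairSum-3 H v)) (proj₁ (non-step-pairSums ro ba v)))
  ∂-allowed⇒antisymmetric {H = H} ro ba (here L1 L4 v _) =
    +-inverseˡ-unique _ _ (trans (sym (pairSum-5 H v)) (proj₁ (proj₂ (non-step-pairSums ro ba v))))
  ∂-allowed⇒antisymmetric {H = H} ro ba (here L4 L1 v _) =
    +-inverseʳ-unique _ _ (trans (sym (pairSum-5 H v)) (proj₁ (proj₂ (non-step-pairSums ro ba v))))
  ∂-allowed⇒antisymmetric {H = H} ro ba (here L2 L4 v _) =
    +-inverseˡ-unique _ _ (trans (sym (pairSum-6 H v)) (proj₁ (proj₂ (proj₂ (non-step-pairSums ro ba v)))))
  ∂-allowed⇒antisymmetric {H = H} ro ba (here L4 L2 v _) =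
    +-inverseʳ-unique _ _ (trans (sym (pairSum-6 H v)) (proj₁ (proj₂ (proj₂ (non-step-pairSums ro ba v)))))
  ∂-allowed⇒antisymmetric {zero}  ro ba (there z ())
  ∂-allowed⇒antisymmetric {suc k} ro ba (there z s) =
    ∂-allowed⇒antisymmetric (rooted-tail ro z) (boundaryAllowed-tail ro ba z) s

  ∂-allowed⇒vanishes-44 : ∀ {k a₀} {g : Vec (Fin n) (suc k) → Carrier} {H} {w} → Rooted a₀ g H →
                          BoundaryAllowedAfter a₀ g → Contains44 w → H w ≈ 0#
  ∂-allowed⇒vanishes-44 {H = H} ro ba (here v) =
    trans (sym (pairSum-8 H v)) (proj₂ (proj₂ (proj₂ (non-step-pairSums ro ba v))))
  ∂-allowed⇒vanishes-44 {zero}  ro ba (there z ())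
  ∂-allowed⇒vanishes-44 {suc k} ro ba (there z c) =
    ∂-allowed⇒vanishes-44 (rooted-tail ro z) (boundaryAllowed-tail ro ba z) c

module Eigenchains {r ℓ} (K : CommutativeRing r ℓ) (n' : ℕ) (8<n : 8 < suc n')
                   (lam : CommutativeRing.Carrier K)
                   (lamⁿ≈1 : CommutativeRing._≈_ K (pow K lam (suc n')) (CommutativeRing.1# K)) where
  open CommutativeRing K hiding (zero)
  open import Algebra.Properties.CommutativeSemigroup *-commutativeSemigroup
    using () renaming (x∙yz≈y∙xz to *-exchange)
  open import Relation.Binary.Reasoning.Setoid setoid
  open import Data.Vec using (map)
  open import Data.Vec.Properties using (≡-dec)
  open import Relation.Nullary using (yes; no)
  open FiniteSums K
  open AlternatingWords K
  open Circulant n' 8<n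

  -- λ^{-a}, written λ^{n ∸ a} as in the definition of f.
  phase : Fin n → Carrier
  phase a = pow K lam (n ∸ toℕ a)

  phase-shift : ∀ a → phase (shift a) ≈ lam * phase a
  phase-shift Fin.zero    = begin
    pow K lam (n ∸ toℕ (shift Fin.zero)) ≡⟨ ≡.cong (λ t → pow K lam (n ∸ t)) toℕ-shift-zero ⟩
    pow K lam (n ∸ n')                  ≡⟨ ≡.cong (pow K lam) (ℕₚ.m+n∸n≡m 1 n') ⟩
    lam * 1#                            ≈⟨ *-congˡ lamⁿ≈1 ⟨
    lam * pow K lam n                   ∎
  phase-shift (Fin.suc j) = reflexive (≡.cong (pow K lam)
    (≡.trans (≡.cong (n ∸_) (toℕ-shift-suc j)) (ℕₚ.+-∸-assoc 1 (ℕₚ.<⇒≤ (Finₚ.toℕ<n j)))))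

  lam-cancelˡ : ∀ {x y} → lam * x ≈ lam * y → x ≈ y
  lam-cancelˡ {x} {y} eq = begin
    x                         ≈⟨ *-identityˡ x ⟨
    1# * x                    ≈⟨ *-congʳ lamⁿ≈1 ⟨
    (lam * pow K lam n') * x  ≈⟨ *-congʳ (*-comm lam _) ⟩
    (pow K lam n' * lam) * x  ≈⟨ *-assoc _ lam x ⟩
    pow K lam n' * (lam * x)  ≈⟨ *-congˡ eq ⟩
    pow K lam n' * (lam * y)  ≈⟨ *-assoc _ lam y ⟨
    (pow K lam n' * lam) * y  ≈⟨ *-congʳ (*-comm _ lam) ⟩
    (lam * pow K lam n') * y  ≈⟨ *-congʳ lamⁿ≈1 ⟩
    1# * y                    ≈⟨ *-identityˡ y ⟩
    y                         ∎

  -- u = Σ_w h(w) f_w^(λ)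
  record Profile {m} (u : Chain K n m) (h : Vec Letter m → Carrier) : Set ℓ where
    field
      supported : InA K n u
      on-walks  : ∀ a w → u (walk n a w) ≈ phase a * h w
  open Profile public

  profile-unique : ∀ {m} {u u' : Chain K n m} {h h'} → Profile u h → Profile u' h' →
                   (∀ w → h w ≈ h' w) → ∀ p → u p ≈ u' p
  profile-unique {u = u} {u'} pr pr' h≈h' p with Allowed? p
  ... | no ¬al = trans (supported pr p ¬al) (sym (supported pr' p ¬al))
  ... | yes al with allowed⇒walk p al
  ...   | w , p≡walk = ≡.subst (λ q → u q ≈ u' q) (≡.sym p≡walk)
            (trans (on-walks pr (head p) w) (trans (*-congˡ (h≈h' w)) (sym (on-walks pr' (head p) w))))

  profile-respects : ∀ {m} {u u' : Chain K n m} {h} → (∀ p → u p ≈ u' p) → Profile u' h → Profile u h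
  profile-respects u≈u' pr = record
    { supported = λ p ¬al → trans (u≈u' p) (supported pr p ¬al)
    ; on-walks  = λ a w → trans (u≈u' _) (on-walks pr a w) }

  profile-zero : ∀ {m} {u : Chain K n m} {h} → Profile u h → (∀ p → u p ≈ 0#) → ∀ w → h w ≈ 0#
  profile-zero {u = u} {h} pr u≈0 w = begin
    h w                    ≈⟨ *-identityˡ (h w) ⟨
    1# * h w               ≈⟨ *-congʳ lamⁿ≈1 ⟨
    phase Fin.zero * h w   ≈⟨ on-walks pr Fin.zero w ⟨
    u (walk n Fin.zero w)  ≈⟨ u≈0 _ ⟩
    0#                     ∎

  profile⇒eigen : ∀ {m} {u : Chain K n m} {h} → Profile u h → ∀ q → τ K n u q ≈ lam * u q
  profile⇒eigen {u = u} {h} pr q with Allowed? q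
  ... | no ¬al = trans (supported pr _ (¬al ∘ Allowed-unshift q))
                       (sym (trans (*-congˡ (supported pr q ¬al)) (zeroʳ lam)))
  ... | yes al with allowed⇒walk q al
  ...   | w , q≡walk = ≡.subst (λ q' → τ K n u q' ≈ lam * u q') (≡.sym q≡walk) (begin
    u (map shift (walk n a w)) ≡⟨ ≡.cong u (shift-walk a w) ⟩
    u (walk n (shift a) w)     ≈⟨ on-walks pr (shift a) w ⟩
    phase (shift a) * h w      ≈⟨ *-congʳ (phase-shift a) ⟩
    (lam * phase a) * h w      ≈⟨ *-assoc lam (phase a) (h w) ⟩
    lam * (phase a * h w)      ≈⟨ *-congˡ (on-walks pr a w) ⟨
    lam * u (walk n a w)       ∎)
    where a = head q

  eigen⇒profile : ∀ {m} {u : Chain K n m} → InA K n u → (∀ q → τ K n u q ≈ lam * u q) →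
                  Profile u (λ w → u (walk n Fin.zero w))
  eigen⇒profile {u = u} supp eigen = record
    { supported = supp
    ; on-walks  = λ a w → byPosition (toℕ a) a ≡.refl w }
    where
    -- The shift takes the walk from a + 1 to the walk from a.
    byPosition : ∀ k a → toℕ a ≡ k → ∀ w → u (walk n a w) ≈ phase a * u (walk n Fin.zero w)
    byPosition zero    Fin.zero    _  w = trans (sym (*-identityˡ _)) (*-congʳ (sym lamⁿ≈1))
    byPosition (suc k) (Fin.suc j) eq w = lam-cancelˡ (begin
      lam * u (walk n (Fin.suc j) w)                     ≈⟨ eigen _ ⟨
      u (map shift (walk n (Fin.suc j) w))               ≡⟨ ≡.cong u (shift-walk (Fin.suc j) w) ⟩
      u (walk n (shift (Fin.suc j)) w)
        ≈⟨ byPosition k _ (≡.trans (toℕ-shift-suc j) (ℕₚ.suc-injective eq)) w ⟩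
      phase (shift (Fin.suc j)) * u (walk n Fin.zero w)  ≈⟨ *-congʳ (phase-shift (Fin.suc j)) ⟩
      (lam * phase (Fin.suc j)) * u (walk n Fin.zero w)  ≈⟨ *-assoc _ _ _ ⟩
      lam * (phase (Fin.suc j) * u (walk n Fin.zero w))  ∎)

  δ-false : ∀ {k} (p q : Vec (Fin n) k) → p ≢ q → ∀ x → x * δ K n p q ≈ 0#
  δ-false p q p≢q x = trans (*-comm x _) (ind-false (dec-false (≡-dec Fin._≟_ p q) p≢q) x)

  f-supported : ∀ {m} (w : Vec Letter m) p → ¬ Allowed n p → f K n lam w p ≈ 0#
  f-supported w p ¬al = sumFin-zero (λ a → δ-false p (walk n a w)
    (λ p≡ → ¬al (≡.subst (Allowed n) (≡.sym p≡) (walk-allowed a w))) (phase a))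

  f-walk : ∀ {m} (w : Vec Letter m) b → f K n lam w (walk n b w) ≈ phase b
  f-walk w b = trans
    (sumFin-single b (λ a a≢b → δ-false (walk n b w) (walk n a w)
      (λ eq → a≢b (≡.sym (proj₁ (walk-injective b a w w eq)))) (phase a)))
    (trans (*-comm _ _) (ind-true (dec-true (≡-dec Fin._≟_ (walk n b w) (walk n b w)) ≡.refl) _))

  f-walk-other : ∀ {m} (w v : Vec Letter m) b → w ≢ v → f K n lam w (walk n b v) ≈ 0#
  f-walk-other w v b w≢v = sumFin-zero (λ a → δ-false (walk n b v) (walk n a w)
    (λ eq → w≢v (≡.sym (proj₂ (walk-injective b a v w eq)))) (phase a))

  -- U_{m,k} is shuffleChain m (m ∸ k) k 0 and V_{m,k} is shuffleChain m (m ∸ (k + 1)) k 1.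
  shuffleChain : ∀ m → ℕ → ℕ → ℕ → Chain K n m
  shuffleChain m a b d p = sumWords K m (λ w → ind K (inSh a b d w) * (sgn K (inv w) * f K n lam w p))

  shuffleChain-walk : ∀ m a b d x (v : Vec Letter m) →
                      shuffleChain m a b d (walk n x v) ≈ phase x * signedShuffle a b d v
  shuffleChain-walk m a b d x v = begin
    shuffleChain m a b d (walk n x v)
      ≈⟨ sumWords-single m v (λ w w≢v →
           trans (*-congˡ (trans (*-congˡ (f-walk-other w v x w≢v)) (zeroʳ _))) (zeroʳ _)) ⟩
    ind K (inSh a b d v) * (sgn K (inv v) * f K n lam v (walk n x v))
      ≈⟨ *-congˡ (*-congˡ (f-walk v x)) ⟩
    ind K (inSh a b d v) * (sgn K (inv v) * phase x)  ≈⟨ *-assoc _ _ _ ⟨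
    signedShuffle a b d v * phase x                   ≈⟨ *-comm _ _ ⟩
    phase x * signedShuffle a b d v                   ∎

  shuffleChain-supported : ∀ m a b d p → ¬ Allowed n p → shuffleChain m a b d p ≈ 0#
  shuffleChain-supported m a b d p ¬al =
    sumWords-zero m (λ w → trans (*-congˡ (trans (*-congˡ (f-supported w p ¬al)) (zeroʳ _))) (zeroʳ _))

  comb-profile : ∀ m cs ds → Profile (comb K n lam m cs ds) (shuffleCombination m cs ds)
  comb-profile m cs ds = record
    { supported = λ p ¬al → trans
        (+-cong (vanish cs (λ k → m ∸ toℕ k) 0 p ¬al) (vanish ds (λ k → m ∸ suc (toℕ k)) 1 p ¬al))
        (+-identityˡ 0#)
    ; on-walks = λ x v → trans
        (+-cong (pull x v cs (λ k → m ∸ toℕ k) 0) (pull x v ds (λ k → m ∸ suc (toℕ k)) 1))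
        (sym (distribˡ (phase x) _ _)) }
    where
    vanish : ∀ {j} (coeff : Fin j → Carrier) (ones : Fin j → ℕ) d p → ¬ Allowed n p →
             sumFin K (λ k → coeff k * shuffleChain m (ones k) (toℕ k) d p) ≈ 0#
    vanish coeff ones d p ¬al = sumFin-zero (λ k →
      trans (*-congˡ (shuffleChain-supported m (ones k) (toℕ k) d p ¬al)) (zeroʳ (coeff k)))
    pull : ∀ {j} x v (coeff : Fin j → Carrier) (ones : Fin j → ℕ) d →
           sumFin K (λ k → coeff k * shuffleChain m (ones k) (toℕ k) d (walk n x v))
           ≈ phase x * sumFin K (λ k → coeff k * signedShuffle (ones k) (toℕ k) d v)
    pull x v coeff ones d = trans
      (sumFin-cong (λ k → trans (*-congˡ (shuffleChain-walk m (ones k) (toℕ k) d x v)) (*-exchange _ _ _)))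
      (sym (*-distribˡ-sumFin (phase x) (λ k → coeff k * signedShuffle (ones k) (toℕ k) d v)))

  open Boundary K n' 8<n using (Rooted; BoundaryAllowedAfter; ∂-cons-no-incoming; neg≈0; neg≈0⇒≈0;
    alternating⇒∂-allowed; ∂-allowed⇒antisymmetric; ∂-allowed⇒vanishes-44)

  Ω⇒alternating : ∀ {e} (u : Chain K n (suc e)) → InΩ K n u → Alternating (λ w → u (walk n Fin.zero w))
  Ω⇒alternating u (inA , ∂-allowed) = record
    { antisymmetric = ∂-allowed⇒antisymmetric rooted allowedAfter
    ; vanishes-44   = ∂-allowed⇒vanishes-44 rooted allowedAfter }
    where
    rooted : Rooted Fin.zero (λ p → u (Fin.zero ∷ p)) (λ w → u (walk n Fin.zero w))
    rooted = record { supported = λ p → inA (Fin.zero ∷ p) ; on-walks = λ _ _ → refl }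
    allowedAfter : BoundaryAllowedAfter Fin.zero (λ p → u (Fin.zero ∷ p))
    allowedAfter q reg ¬al = neg≈0⇒≈0 (trans
      (sym (∂-cons-no-incoming u Fin.zero q (λ v → inA (v ∷ Fin.zero ∷ q) (¬al ∘ proj₂))))
      (∂-allowed (Fin.zero ∷ q) reg ¬al))

  alternating⇒Ω : ∀ {e} (u : Chain K n (suc e)) {h} → Profile u h → Alternating h → InΩ K n u
  alternating⇒Ω u {h} pr alt = supported pr , ∂-allowed
    where
    ∂-allowed : ∀ q → Regular n q → ¬ Allowed n q → bd K n u q ≈ 0#
    ∂-allowed (a ∷ q) _ ¬al = trans
      (∂-cons-no-incoming u a q (λ v → supported pr (v ∷ a ∷ q) (¬al ∘ proj₂)))
      (neg≈0 (alternating⇒∂-allowed rooted (alternating-scale (phase a) alt) q ¬al))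
      where
      rooted : Rooted a (λ p → u (a ∷ p)) (λ w → phase a * h w)
      rooted = record { supported = λ p → supported pr (a ∷ p) ; on-walks = λ s w → on-walks pr a (s ∷ w) }

  Ωλ⇒span : ∀ {e} (u : Chain K n (suc e)) → InΩλ K n lam u → InSpanUV K n lam (suc e) u
  Ωλ⇒span {e} u (inΩ , eigen) = cs , ds ,
    profile-unique (eigen⇒profile (proj₁ inΩ) eigen) (comb-profile (suc e) cs ds)
                   (alternating-expansion (Ω⇒alternating u inΩ))
    where
    h  = λ w → u (walk n Fin.zero w)
    cs = λ k → h (sortedU (suc e) k)
    ds = λ k → h (sortedV (suc e) k)

  span⇒Ωλ : ∀ {e} (u : Chain K n (suc e)) → InSpanUV K n lam (suc e) u → InΩλ K n lam u
  span⇒Ωλ {e} u (cs , ds , u≈comb) =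
    alternating⇒Ω u profile (shuffleCombination-alternating (suc e) cs ds) , profile⇒eigen profile
    where
    profile = profile-respects u≈comb (comb-profile (suc e) cs ds)

  UV-independent : ∀ m → IndependentUV K n lam m
  UV-independent m cs ds comb≈0 =
    (λ k → trans (sym (shuffleCombination-sortedU m cs ds k)) (coefficients≈0 (sortedU m k))) ,
    (λ k → trans (sym (shuffleCombination-sortedV m cs ds k)) (coefficients≈0 (sortedV m k)))
    where
    coefficients≈0 = profile-zero (comb-profile m cs ds) comb≈0

lemmaA1 : ∀ {c ℓ} (K : CommutativeRing c ℓ) → IsField K → CharZero K →
    (n : ℕ) {{_ : NonZero n}} → 10 < n → HasAllRootsOfUnity K n →
    (lam : CommutativeRing.Carrier K) →
    CommutativeRing._≈_ K (pow K lam n) (CommutativeRing.1# K) →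
    (e : ℕ) →
    (∀ (u : Chain K n (suc e)) → InΩλ K n lam u ⇔ InSpanUV K n lam (suc e) u)
    × IndependentUV K n lam (suc e)
lemmaA1 K _ _ (suc n') 10<n _ lam lamⁿ≈1 e =
  (λ u → mk⇔ (Ωλ⇒span u) (span⇒Ωλ u)) , UV-independent (suc e)
  where open Eigenchains K n' (ℕₚ.m+n≤o⇒n≤o 2 10<n) lam lamⁿ≈1
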